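{- Let $F$ be a $4$-flipclass of $\mathfrak S_n$. Then the support graph $S_F$ and the time-support graph $TS_F$ are isomorphic (as edge-labelled directed graphs).
   Context: $\mathfrak S_n$: symmetric group on $[n]$, $\ell$ Coxeter length, $T$ transpositions. Bruhat graph $B(\mathfrak S_n)$: edge $x\xrightarrow{t}y$ labelled $t$ whenever $yx^{ -1}=t\in T$ and $\ell(x)<\ell(y)$. $P_h(u,v)$: directed paths of length $h$ from $u$ to $v$. Between two elements there are 0 or 2 paths of length 2, each the flip of the other; $f_i$ ($i\in[h-1]$) replaces the subpath $x_{i-1}\to x_i\to x_{i+1}$ by its flip; an $h$-flipclass is an orbit in some $P_h(u,v)$ of the group generated by $f_1,\dots,f_{h-1}$. For such $F$: the support graph $S_F$ is the edge-labelled subgraph of $B(\mathfrak S_n)$ consisting of the vertices and edges occurring in paths of $F$; the time-support graph $TS_F$ has vertices $(a,i)\in\mathfrak S_n\times\{0,\dots,h\}$ such that some path $x_0\to\cdots\to x_h$ of $F$ has $x_i=a$, and an edge $(a,i)\xrightarrow{t}(b,i+1)$ whenever some path of $F$ has $x_i=a$, $x_{i+1}=b$ with that edge labelled $t$. -}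

module Defs where

open import Data.Nat using (ℕ; zero; suc; _<_)
open import Data.Nat as ℕ using ()
open import Data.Fin as Fin using (Fin; toℕ; inject₁; _≟_)
open import Data.Fin.Base using () renaming (_<_ to _<ᶠ_)
open import Data.Fin.Properties using (_<?_)
open import Data.Vec using (Vec; lookup; map)
open import Data.List using (List; allFin)
open import Data.Nat.ListAction using (sum)
import Data.List as List
open import Data.Product using (Σ; ∃; ∃-syntax; _×_; _,_)
open import Data.Bool using (if_then_else_; _∧_)
open import Relation.Nullary using (¬_; does)
open import Relation.Binary.PropositionalEquality using (_≡_; _≢_)
open import Relation.Binary.Construct.Closure.ReflexiveTransitive using (Star)

-- A permutation of [n] in one-line notation: the word x(1) x(2) ... x(n),
-- with the positions and values indexed by Fin n.
Word : ℕ → Set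
Word n = Vec (Fin n) n

IsPerm : ∀ {n} → Word n → Set
IsPerm {n} x = ∀ (i j : Fin n) → lookup x i ≡ lookup x j → i ≡ j

-- Coxeter length of a permutation of S_n = number of inversions.
len : ∀ {n} → Word n → ℕ
len {n} x = sum (List.map (λ i → sum (List.map (λ j →
  if does (i <? j) ∧ does (lookup x j <? lookup x i) then 1 else 0)
  (allFin n))) (allFin n))

-- A transposition (a b) with a < b is represented by the pair (a , b).
Transp : ℕ → Set
Transp n = Fin n × Fin n

swapFin : ∀ {n} → Fin n → Fin n → Fin n → Fin n
swapFin a b k = if does (k ≟ a) then b else (if does (k ≟ b) then a else k)

-- Bruhat graph edge x --t--> y : y x⁻¹ = t (i.e. y = t ∘ x) and ℓ(x) < ℓ(y).
BEdge : ∀ {n} → Word n → Transp n → Word n → Set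
BEdge x (a , b) y = (a <ᶠ b) × (y ≡ map (swapFin a b) x) × (len x < len y)

Path : ℕ → ℕ → Set
Path n h = Vec (Word n) (suc h)

IsPath : ∀ {n h} → Path n h → Set
IsPath {n} {h} p =
  (∀ (k : Fin (suc h)) → IsPerm (lookup p k)) ×
  (∀ (i : Fin h) → ∃[ t ] BEdge (lookup p (inject₁ i)) t (lookup p (Fin.suc i)))

-- One flip f_i: q is obtained from the path p by replacing the subpath
-- x_{i-1} → x_i → x_{i+1} (0 < i < h) by another length-2 path with the
-- same endpoints (which, by the 0-or-2 fact, is its flip).
Flip : ∀ {n h} → Path n h → Path n h → Set
Flip {n} {h} p q = IsPath p × IsPath q ×
  (∃[ k ] ((0 < toℕ k) × (toℕ k < h) ×
           (∀ (j : Fin (suc h)) → j ≢ k → lookup p j ≡ lookup q j)))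

InClass : ∀ {n h} → Path n h → Path n h → Set
InClass p q = Star Flip p q

record LGraph (V L : Set) : Set₁ where
  field
    Vert : V → Set
    Edge : V → L → V → Set

record Iso {V W L : Set} (G : LGraph V L) (H : LGraph W L) : Set where
  open LGraph
  field
    to     : V → W
    from   : W → V
    to-V   : ∀ v → Vert G v → Vert H (to v)
    from-V : ∀ w → Vert H w → Vert G (from w)
    from∘to : ∀ v → Vert G v → from (to v) ≡ v
    to∘from : ∀ w → Vert H w → to (from w) ≡ w
    edge-to   : ∀ v t v' → Vert G v → Vert G v' →
                Edge G v t v' → Edge H (to v) t (to v')
    edge-from : ∀ v t v' → Vert G v → Vert G v' →
                Edge H (to v) t (to v') → Edge G v t v'

Support : ∀ {n h} → Path n h → LGraph (Word n) (Transp n)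
Support {n} {h} p = record
  { Vert = λ a → ∃[ q ] (InClass p q × ∃[ k ] (lookup q k ≡ a))
  ; Edge = λ a t b → ∃[ q ] (InClass p q × ∃[ i ]
      ((lookup q (inject₁ i) ≡ a) × (lookup q (Fin.suc i) ≡ b) × BEdge a t b))
  }

TimeSupport : ∀ {n h} → Path n h → LGraph (Word n × Fin (suc h)) (Transp n)
TimeSupport {n} {h} p = record
  { Vert = λ { (a , k) → ∃[ q ] (InClass p q × (lookup q k ≡ a)) }
  ; Edge = λ { (a , k) t (b , k') → ∃[ q ] (InClass p q × ∃[ i ]
      ((inject₁ i ≡ k) × (Fin.suc i ≡ k') ×
       (lookup q (inject₁ i) ≡ a) × (lookup q (Fin.suc i) ≡ b) × BEdge a t b)) }
  }

{-# OPTIONS --safe #-}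
module Submission where

-- All paths of F run from u to v, lengths strictly increase along them, and
-- a product of two distinct transpositions is never a transposition.  Hence a vertex of
-- S_F can occur at two different times only if it is adjacent to both u and v and
-- occurs at time 1 in one path and at time 3 in another.  Flips preserve the partition
-- of [n] generated by the labels of a path.  A vertex a at time 1, with v = (r z) a,
-- is followed by three labels living on a triple {e, r, z} with e linked to r, and each
-- of these Bruhat steps inverts a further pair of the triple, so a is sorted on it.  At
-- time 3, with a = (c d) u, the vertex a is reversed on a triple {e′, c, d} carrying the
-- first three labels, and the partition forces e and one of r, z into that triple.
-- So the time of a vertex is a function of the vertex, and a ↦ (a , time a) is the
-- required isomorphism.

open import Defs
open import Data.Nat using (ℕ)

open import Data.Nat as ℕ using (zero; suc; _+_; z≤n; s≤s)
import Data.Nat.Properties as ℕP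
import Data.Nat.ListAction as ListSum
open import Data.Bool as Bool using (Bool; true; false; not; _∧_; _xor_; if_then_else_; f≤t; b≤b)
import Data.Bool.Properties as BoolP
open import Data.Fin as Fin using (Fin; toℕ; inject₁; _≟_; _<_)
open import Data.Fin.Patterns using (0F; 1F; 2F; 3F; 4F)
open import Data.Fin.Properties as FinP using (_<?_)
import Data.Fin.Permutation as Perm
open import Data.Fin.Subset using (Subset)
open import Data.Fin.Subset.Properties using (anySubset?)
open import Data.Vec as Vec using (Vec; lookup; map; []; _∷_)
import Data.Vec.Properties as VecP
open import Data.List as List using (List; allFin; _++_) renaming ([] to []ᴸ; _∷_ to _∷ᴸ_)
import Data.List.Properties as ListP
open import Data.List.Relation.Unary.Any using (here; there; any?)
open import Data.List.Membership.Propositional using (_∈_; _∉_)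
open import Data.List.Membership.Propositional.Properties using (∈-++⁺ˡ; ∈-++⁺ʳ; ∈-++⁻)
open import Data.List.Relation.Binary.Subset.Propositional using (_⊆_)
open import Data.Product using (∃; ∃₂; _×_; _,_; proj₁; proj₂)
open import Data.Sum using (_⊎_; inj₁; inj₂)
open import Data.Empty using (⊥; ⊥-elim)
open import Function using (_∘_; _∘′_; flip; case_of_)
open import Algebra.Properties.CommutativeMonoid.Sum ℕP.+-0-commutativeMonoid
  using (sum; sum-cong-≗; ∑-distrib-+; ∑-permute)
open import Algebra.Properties.CommutativeSemigroup ℕP.+-commutativeSemigroup
  using (x∙yz≈y∙xz; xy∙z≈xz∙y)
open import Relation.Nullary using (¬_; does; yes; no; Dec)
open import Relation.Nullary.Decidable
  using (dec-true; dec-false; decidable-stable; _×-dec_; _→-dec_; ¬?)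
open import Relation.Nullary.Negation using (contradiction)
open import Relation.Binary.Definitions using (tri<; tri≈; tri>)
open import Relation.Binary.PropositionalEquality
open import Relation.Binary.Construct.Closure.ReflexiveTransitive as Star using (ε; _◅_)

private variable
  n : ℕ
  a b e k m r z u v w : Fin n
  s t α β γ δ τ : Transp n
  x y x₀ x₁ x₂ x₃ : Word n
  h : ℕ
  p q : Path n h
  S : Subset n

-- Transpositions of [n]

infix 4 _∈?_

_∈?_ : (k : Fin n) (ks : List (Fin n)) → Dec (k ∈ ks)
k ∈? ks = any? (k ≟_) ks

swapFin-left : (a b : Fin n) → swapFin a b a ≡ b
swapFin-left a b rewrite dec-true (a ≟ a) refl = refl

swapFin-right : (a b : Fin n) → swapFin a b b ≡ a
swapFin-right a b with b ≟ a
... | yes b≡a = b≡a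
... | no _ rewrite dec-true (b ≟ b) refl = refl

swapFin-other : (a b : Fin n) → k ≢ a → k ≢ b → swapFin a b k ≡ k
swapFin-other {k = k} a b k≢a k≢b
  rewrite dec-false (k ≟ a) k≢a | dec-false (k ≟ b) k≢b = refl

swapFin-cases : (a b k : Fin n) →
  (k ≡ a × swapFin a b k ≡ b) ⊎ (k ≡ b × swapFin a b k ≡ a) ⊎ (k ≢ a × k ≢ b × swapFin a b k ≡ k)
swapFin-cases a b k with k ≟ a
... | yes refl = inj₁ (refl , refl)
... | no k≢a with k ≟ b
...   | yes refl = inj₂ (inj₁ (refl , refl))
...   | no k≢b = inj₂ (inj₂ (k≢a , k≢b , refl))

swapFin-involutive : (a b k : Fin n) → swapFin a b (swapFin a b k) ≡ k
swapFin-involutive a b k with swapFin-cases a b k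
... | inj₁ (refl , e) = trans (cong (swapFin a b) e) (swapFin-right a b)
... | inj₂ (inj₁ (refl , e)) = trans (cong (swapFin a b) e) (swapFin-left a b)
... | inj₂ (inj₂ (_ , _ , e)) = trans (cong (swapFin a b) e) e

swapFin-injective : (a b : Fin n) → swapFin a b k ≡ swapFin a b m → k ≡ m
swapFin-injective {k = k} {m} a b e = begin
  k                                 ≡⟨ swapFin-involutive a b k ⟨
  swapFin a b (swapFin a b k)       ≡⟨ cong (swapFin a b) e ⟩
  swapFin a b (swapFin a b m)       ≡⟨ swapFin-involutive a b m ⟩
  m                                 ∎
  where open ≡-Reasoning

swapFin-moved : (a b : Fin n) → swapFin a b k ≡ m → k ≢ m → (k ≡ a × m ≡ b) ⊎ (k ≡ b × m ≡ a)
swapFin-moved {k = k} a b k↦m k≢m with swapFin-cases a b k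
... | inj₁ (k≡a , e) = inj₁ (k≡a , trans (sym k↦m) e)
... | inj₂ (inj₁ (k≡b , e)) = inj₂ (k≡b , trans (sym k↦m) e)
... | inj₂ (inj₂ (_ , _ , e)) = contradiction (trans (sym e) k↦m) k≢m

⟦_⟧ : Transp n → Fin n → Fin n
⟦ a , b ⟧ = swapFin a b

supp : Transp n → List (Fin n)
supp (a , b) = a ∷ᴸ b ∷ᴸ []ᴸ

IsTransp : Transp n → Set
IsTransp (a , b) = a < b

Disjoint : Transp n → Transp n → Set
Disjoint s t = ∀ {k} → k ∈ supp s → k ∉ supp t

⟦⟧-involutive : (t : Transp n) (k : Fin n) → ⟦ t ⟧ (⟦ t ⟧ k) ≡ k
⟦⟧-involutive (a , b) = swapFin-involutive a b

⟦⟧-fixes : k ∉ supp t → ⟦ t ⟧ k ≡ k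
⟦⟧-fixes {t = a , b} k∉t =
  swapFin-other a b (λ k≡a → k∉t (here k≡a)) (λ k≡b → k∉t (there (here k≡b)))

⟦⟧-stays-in-supp : k ∈ supp t → ⟦ t ⟧ k ∈ supp t
⟦⟧-stays-in-supp {t = a , b} (here refl) = there (here (swapFin-left a b))
⟦⟧-stays-in-supp {t = a , b} (there (here refl)) = here (swapFin-right a b)

moved⇒∈supp : ⟦ t ⟧ k ≢ k → k ∈ supp t
moved⇒∈supp {t = t} {k = k} moved with k ∈? supp t
... | yes k∈t = k∈t
... | no k∉t = contradiction (⟦⟧-fixes k∉t) moved

transp-≡ : {a b c d : Fin n} → IsTransp (a , b) → IsTransp (c , d) →
           (a ≡ c × b ≡ d) ⊎ (a ≡ d × b ≡ c) → (a , b) ≡ (c , d)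
transp-≡ _ _ (inj₁ (refl , refl)) = refl
transp-≡ a<b c<d (inj₂ (refl , refl)) = contradiction a<b (FinP.<-asym c<d)

transp-unique-at : IsTransp s → IsTransp t → k ∈ supp s → ⟦ s ⟧ k ≡ ⟦ t ⟧ k → s ≡ t
transp-unique-at {s = a , b} {t = c , d} a<b c<d (here refl) e =
  transp-≡ a<b c<d (swapFin-moved c d (trans (sym e) (swapFin-left a b)) (FinP.<⇒≢ a<b))
transp-unique-at {s = a , b} {t = c , d} a<b c<d (there (here refl)) e
  with swapFin-moved c d (trans (sym e) (swapFin-right a b)) (FinP.<⇒≢ a<b ∘′ sym)
... | inj₁ (b≡c , a≡d) = transp-≡ a<b c<d (inj₂ (a≡d , b≡c))
... | inj₂ (b≡d , a≡c) = transp-≡ a<b c<d (inj₁ (a≡c , b≡d))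

transp-unique : IsTransp s → IsTransp t → (∀ k → ⟦ s ⟧ k ≡ ⟦ t ⟧ k) → s ≡ t
transp-unique {s = a , b} ps pt s≗t = transp-unique-at ps pt (here refl) (s≗t a)

supp-⊆⇒≡ : IsTransp s → IsTransp t → supp s ⊆ supp t → s ≡ t
supp-⊆⇒≡ {s = a , b} {t = c , d} a<b c<d s⊆t with s⊆t (here refl) | s⊆t (there (here refl))
... | here a≡c | here b≡c = contradiction (trans a≡c (sym b≡c)) (FinP.<⇒≢ a<b)
... | here a≡c | there (here b≡d) = transp-≡ a<b c<d (inj₁ (a≡c , b≡d))
... | there (here a≡d) | here b≡c = transp-≡ a<b c<d (inj₂ (a≡d , b≡c))
... | there (here a≡d) | there (here b≡d) = contradiction (trans a≡d (sym b≡d)) (FinP.<⇒≢ a<b)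

product-id⇒≡ : IsTransp s → IsTransp t → (∀ k → ⟦ s ⟧ (⟦ t ⟧ k) ≡ k) → t ≡ s
product-id⇒≡ {s = s} {t = t} ps pt st≗id =
  transp-unique pt ps λ k → trans (sym (⟦⟧-involutive s _)) (cong ⟦ s ⟧ (st≗id k))

product-moves : IsTransp γ → IsTransp δ → γ ≢ δ → k ∈ supp γ ⊎ k ∈ supp δ → ⟦ δ ⟧ (⟦ γ ⟧ k) ≢ k
product-moves {γ = γ} {δ = δ} {k = k} pγ pδ γ≢δ k∈ δγk≡k = γ≢δ (agree k∈)
  where
  γk≡δk : ⟦ γ ⟧ k ≡ ⟦ δ ⟧ k
  γk≡δk = trans (sym (⟦⟧-involutive δ _)) (cong ⟦ δ ⟧ δγk≡k)
  agree : k ∈ supp γ ⊎ k ∈ supp δ → γ ≡ δ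
  agree (inj₁ k∈γ) = transp-unique-at pγ pδ k∈γ γk≡δk
  agree (inj₂ k∈δ) = sym (transp-unique-at pδ pγ k∈δ (sym γk≡δk))

-- Every point moved by γ or by δ ≠ γ is moved by δ ∘ γ = β ∘ α.
product-support : IsTransp γ → IsTransp δ → γ ≢ δ →
  (∀ k → ⟦ β ⟧ (⟦ α ⟧ k) ≡ ⟦ δ ⟧ (⟦ γ ⟧ k)) →
  k ∈ supp γ ⊎ k ∈ supp δ → k ∈ supp α ⊎ k ∈ supp β
product-support {γ = γ} {δ = δ} {β = β} {α = α} {k = k} pγ pδ γ≢δ βα≗δγ k∈
  with k ∈? supp α | k ∈? supp β
... | yes k∈α | _ = inj₁ k∈α
... | no _ | yes k∈β = inj₂ k∈β
... | no k∉α | no k∉β = contradiction fixed (product-moves pγ pδ γ≢δ k∈)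
  where
  fixed : ⟦ δ ⟧ (⟦ γ ⟧ k) ≡ k
  fixed = trans (sym (βα≗δγ k)) (trans (cong ⟦ β ⟧ (⟦⟧-fixes k∉α)) (⟦⟧-fixes k∉β))

product-not-transp : IsTransp α → IsTransp β → IsTransp τ → α ≢ β →
  ¬ (∀ k → ⟦ β ⟧ (⟦ α ⟧ k) ≡ ⟦ τ ⟧ k)
product-not-transp {α = α} {β = β} {τ = τ} pα pβ pτ α≢β βα≗τ =
  α≢β (trans (≡τ pα inj₁) (sym (≡τ pβ inj₂)))
  where
  ≡τ : IsTransp t → (∀ {k} → k ∈ supp t → k ∈ supp α ⊎ k ∈ supp β) → t ≡ τ
  ≡τ pt t⊆αβ = supp-⊆⇒≡ pt pτ λ {k} k∈t →
    moved⇒∈supp {t = τ} {k = k} λ τk≡k →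
      product-moves {k = k} pα pβ α≢β (t⊆αβ k∈t) (trans (βα≗τ k) τk≡k)

-- Orbit argument: for δ ≠ γ = (c₁ c₂), c₂ is the image of c₁ under δ ∘ γ or (δ ∘ γ)².
colour-product : {A : Set} (f : Fin n → A) → IsTransp γ → IsTransp δ → γ ≢ δ →
  (∀ k → f (⟦ δ ⟧ (⟦ γ ⟧ k)) ≡ f k) → f (proj₁ γ) ≡ f (proj₂ γ)
colour-product {γ = c₁ , c₂} {δ = δ} f pγ pδ γ≢δ δγ-invariant = by-cases (⟦ δ ⟧ c₂ ≟ c₂)
  where
  at-c₁ : f (⟦ δ ⟧ c₂) ≡ f c₁
  at-c₁ = trans (cong (f ∘ ⟦ δ ⟧) (sym (swapFin-left c₁ c₂))) (δγ-invariant c₁)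
  by-cases : Dec (⟦ δ ⟧ c₂ ≡ c₂) → f c₁ ≡ f c₂
  by-cases (yes fixed) = trans (sym at-c₁) (cong f fixed)
  by-cases (no moved) = begin
    f c₁                                ≡⟨ at-c₁ ⟨
    f (⟦ δ ⟧ c₂)                        ≡⟨ δγ-invariant (⟦ δ ⟧ c₂) ⟨
    f (⟦ δ ⟧ (⟦ c₁ , c₂ ⟧ (⟦ δ ⟧ c₂)))  ≡⟨ cong (f ∘ ⟦ δ ⟧) (⟦⟧-fixes {t = c₁ , c₂} δc₂∉γ) ⟩
    f (⟦ δ ⟧ (⟦ δ ⟧ c₂))                ≡⟨ cong f (⟦⟧-involutive δ c₂) ⟩
    f c₂                                ∎
    where
    open ≡-Reasoning
    δc₂∉γ : ⟦ δ ⟧ c₂ ∉ c₁ ∷ᴸ c₂ ∷ᴸ []ᴸ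
    δc₂∉γ (here δc₂≡c₁) =
      γ≢δ (transp-unique-at pγ pδ (there (here refl)) (trans (swapFin-right c₁ c₂) (sym δc₂≡c₁)))
    δc₂∉γ (there (here δc₂≡c₂)) = moved δc₂≡c₂

other-endpoint : IsTransp s → IsTransp t → s ≢ t → k ∈ supp s → k ∈ supp t →
  ∃ λ e → e ∉ supp t × supp s ⊆ e ∷ᴸ supp t
other-endpoint {s = a , b} ps pt s≢t (here refl) a∈t =
  b , (λ b∈t → s≢t (supp-⊆⇒≡ ps pt λ { (here refl) → a∈t ; (there (here refl)) → b∈t })) ,
  λ { (here refl) → there a∈t ; (there (here refl)) → here refl }
other-endpoint {s = a , b} ps pt s≢t (there (here refl)) b∈t =
  a , (λ a∈t → s≢t (supp-⊆⇒≡ ps pt λ { (here refl) → a∈t ; (there (here refl)) → b∈t })) ,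
  λ { (here refl) → here refl ; (there (here refl)) → there b∈t }

meet-or-disjoint : (s t : Transp n) → (∃ λ k → k ∈ supp s × k ∈ supp t) ⊎ Disjoint s t
meet-or-disjoint (a , b) t with a ∈? supp t | b ∈? supp t
... | yes a∈t | _ = inj₁ (a , here refl , a∈t)
... | no _ | yes b∈t = inj₁ (b , there (here refl) , b∈t)
... | no a∉t | no b∉t = inj₂ λ { (here refl) → a∉t ; (there (here refl)) → b∉t }

reverse-product : (∀ k → ⟦ γ ⟧ (⟦ β ⟧ (⟦ α ⟧ k)) ≡ ⟦ τ ⟧ k) →
                  ∀ k → ⟦ α ⟧ (⟦ β ⟧ (⟦ γ ⟧ k)) ≡ ⟦ τ ⟧ k
reverse-product {γ = γ} {β = β} {α = α} {τ = τ} γβα≗τ k = begin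
  ⟦ α ⟧ (⟦ β ⟧ (⟦ γ ⟧ k))
    ≡⟨ ⟦⟧-involutive τ (⟦ α ⟧ (⟦ β ⟧ (⟦ γ ⟧ k))) ⟨
  ⟦ τ ⟧ (⟦ τ ⟧ (⟦ α ⟧ (⟦ β ⟧ (⟦ γ ⟧ k))))
    ≡⟨ cong ⟦ τ ⟧ (γβα≗τ (⟦ α ⟧ (⟦ β ⟧ (⟦ γ ⟧ k)))) ⟨
  ⟦ τ ⟧ (⟦ γ ⟧ (⟦ β ⟧ (⟦ α ⟧ (⟦ α ⟧ (⟦ β ⟧ (⟦ γ ⟧ k))))))
    ≡⟨ cong (λ j → ⟦ τ ⟧ (⟦ γ ⟧ (⟦ β ⟧ j))) (⟦⟧-involutive α (⟦ β ⟧ (⟦ γ ⟧ k))) ⟩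
  ⟦ τ ⟧ (⟦ γ ⟧ (⟦ β ⟧ (⟦ β ⟧ (⟦ γ ⟧ k))))
    ≡⟨ cong (λ j → ⟦ τ ⟧ (⟦ γ ⟧ j)) (⟦⟧-involutive β (⟦ γ ⟧ k)) ⟩
  ⟦ τ ⟧ (⟦ γ ⟧ (⟦ γ ⟧ k))
    ≡⟨ cong ⟦ τ ⟧ (⟦⟧-involutive γ k) ⟩
  ⟦ τ ⟧ k ∎
  where open ≡-Reasoning

widen-supp : supp s ⊆ e ∷ᴸ supp t → k ∈ supp t ⊎ k ∈ supp s → k ∈ e ∷ᴸ supp t
widen-supp _ (inj₁ k∈t) = there k∈t
widen-supp s⊆ (inj₂ k∈s) = s⊆ k∈s

conjugation-by-disjoint : IsTransp α → IsTransp β → IsTransp γ → IsTransp τ →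
  (∀ k → ⟦ β ⟧ (⟦ α ⟧ k) ≡ ⟦ γ ⟧ (⟦ τ ⟧ k)) → Disjoint γ τ → Disjoint α τ → β ≡ τ × γ ≡ α
conjugation-by-disjoint {α = α} {β = β} {γ = γ} {τ = τ} pα pβ pγ pτ βα≗γτ γ∤τ α∤τ = β≡τ , γ≡α
  where
  open ≡-Reasoning
  β≡τ : β ≡ τ
  β≡τ = sym (transp-unique-at pτ pβ (here refl) (begin
    ⟦ τ ⟧ (proj₁ τ)
      ≡⟨ ⟦⟧-fixes {t = γ} (λ x∈γ → γ∤τ x∈γ (⟦⟧-stays-in-supp {t = τ} (here refl))) ⟨
    ⟦ γ ⟧ (⟦ τ ⟧ (proj₁ τ))
      ≡⟨ βα≗γτ (proj₁ τ) ⟨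
    ⟦ β ⟧ (⟦ α ⟧ (proj₁ τ))
      ≡⟨ cong ⟦ β ⟧ (⟦⟧-fixes {t = α} λ r∈α → α∤τ r∈α (here refl)) ⟩
    ⟦ β ⟧ (proj₁ τ) ∎))
  γ≡α : γ ≡ α
  γ≡α = transp-unique-at pγ pα (here refl) (begin
    ⟦ γ ⟧ (proj₁ γ)
      ≡⟨ ⟦⟧-fixes {t = τ} (γ∤τ (⟦⟧-stays-in-supp {t = γ} (here refl))) ⟨
    ⟦ τ ⟧ (⟦ γ ⟧ (proj₁ γ))
      ≡⟨ cong (λ j → ⟦ τ ⟧ (⟦ γ ⟧ j)) (⟦⟧-fixes {t = τ} (γ∤τ (here refl))) ⟨
    ⟦ τ ⟧ (⟦ γ ⟧ (⟦ τ ⟧ (proj₁ γ)))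
      ≡⟨ cong ⟦ τ ⟧ (βα≗γτ (proj₁ γ)) ⟨
    ⟦ τ ⟧ (⟦ β ⟧ (⟦ α ⟧ (proj₁ γ)))
      ≡⟨ cong (λ b → ⟦ τ ⟧ (⟦ b ⟧ (⟦ α ⟧ (proj₁ γ)))) β≡τ ⟩
    ⟦ τ ⟧ (⟦ τ ⟧ (⟦ α ⟧ (proj₁ γ)))
      ≡⟨ ⟦⟧-involutive τ _ ⟩
    ⟦ α ⟧ (proj₁ γ) ∎)

-- Either γ or α meets τ, and then product-support confines all three labels to τ and
-- the other endpoint of that label; or both are disjoint from τ.
three-transp : IsTransp α → IsTransp β → IsTransp γ → IsTransp τ → α ≢ β → β ≢ γ →
  (∀ k → ⟦ γ ⟧ (⟦ β ⟧ (⟦ α ⟧ k)) ≡ ⟦ τ ⟧ k) →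
  (β ≡ τ × γ ≡ α × Disjoint α τ) ⊎
  (∃ λ e → e ∉ supp τ × supp α ⊆ e ∷ᴸ supp τ × supp β ⊆ e ∷ᴸ supp τ × supp γ ⊆ e ∷ᴸ supp τ)
three-transp {α = α} {β = β} {γ = γ} {τ = τ} pα pβ pγ pτ α≢β β≢γ γβα≗τ =
  classify (meet-or-disjoint γ τ) (meet-or-disjoint α τ)
  where
  βα≗γτ : ∀ k → ⟦ β ⟧ (⟦ α ⟧ k) ≡ ⟦ γ ⟧ (⟦ τ ⟧ k)
  βα≗γτ k = trans (sym (⟦⟧-involutive γ _)) (cong ⟦ γ ⟧ (γβα≗τ k))
  βγ≗ατ : ∀ k → ⟦ β ⟧ (⟦ γ ⟧ k) ≡ ⟦ α ⟧ (⟦ τ ⟧ k)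
  βγ≗ατ k = trans (sym (⟦⟧-involutive α _)) (cong ⟦ α ⟧ (reverse-product γβα≗τ k))
  γ≢τ : γ ≢ τ
  γ≢τ γ≡τ = α≢β (product-id⇒≡ pβ pα λ k →
    trans (βα≗γτ k) (trans (cong (λ g → ⟦ g ⟧ (⟦ τ ⟧ k)) γ≡τ) (⟦⟧-involutive τ k)))
  α≢τ : α ≢ τ
  α≢τ α≡τ = β≢γ (sym (product-id⇒≡ pβ pγ λ k →
    trans (βγ≗ατ k) (trans (cong (λ g → ⟦ g ⟧ (⟦ τ ⟧ k)) α≡τ) (⟦⟧-involutive τ k))))
  αβ⊆τγ : ∀ {k} → k ∈ supp α ⊎ k ∈ supp β → k ∈ supp τ ⊎ k ∈ supp γ
  αβ⊆τγ {k} = product-support {β = γ} {α = τ} {k = k} pα pβ α≢β (λ j → sym (βα≗γτ j))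
  γβ⊆τα : ∀ {k} → k ∈ supp γ ⊎ k ∈ supp β → k ∈ supp τ ⊎ k ∈ supp α
  γβ⊆τα {k} = product-support {β = α} {α = τ} {k = k} pγ pβ (β≢γ ∘′ sym) (λ j → sym (βγ≗ατ j))
  classify : (∃ λ k → k ∈ supp γ × k ∈ supp τ) ⊎ Disjoint γ τ →
             (∃ λ k → k ∈ supp α × k ∈ supp τ) ⊎ Disjoint α τ →
             (β ≡ τ × γ ≡ α × Disjoint α τ) ⊎
             (∃ λ e → e ∉ supp τ × supp α ⊆ e ∷ᴸ supp τ × supp β ⊆ e ∷ᴸ supp τ ×
                      supp γ ⊆ e ∷ᴸ supp τ)
  classify (inj₁ (k , k∈γ , k∈τ)) _ =
    let e , e∉τ , γ⊆ = other-endpoint pγ pτ γ≢τ k∈γ k∈τ in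
    inj₂ (e , e∉τ , (λ k∈α → widen-supp γ⊆ (αβ⊆τγ (inj₁ k∈α))) ,
                    (λ k∈β → widen-supp γ⊆ (αβ⊆τγ (inj₂ k∈β))) , γ⊆)
  classify (inj₂ _) (inj₁ (k , k∈α , k∈τ)) =
    let e , e∉τ , α⊆ = other-endpoint pα pτ α≢τ k∈α k∈τ in
    inj₂ (e , e∉τ , α⊆ , (λ k∈β → widen-supp α⊆ (γβ⊆τα (inj₂ k∈β))) ,
                         (λ k∈γ → widen-supp α⊆ (γβ⊆τα (inj₁ k∈γ))))
  classify (inj₂ γ∤τ) (inj₂ α∤τ) =
    let β≡τ , γ≡α = conjugation-by-disjoint pα pβ pγ pτ βα≗γτ γ∤τ α∤τ in
    inj₁ (β≡τ , γ≡α , α∤τ)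

-- Permutation words

-- Pigeonhole: a missed value would give an injection Fin (suc n) → Fin n.
perm-surjective : (x : Word n) → IsPerm x → ∀ v → ∃ λ i → lookup x i ≡ v
perm-surjective {n = suc n} x x-inj v with FinP.any? (λ i → lookup x i ≟ v)
... | yes found = found
... | no missed = contradiction (FinP.injective⇒≤ punched-injective) ℕP.1+n≰n
  where
  punched : Fin (suc n) → Fin n
  punched i = Fin.punchOut {i = v} λ v≡xi → missed (i , sym v≡xi)
  punched-injective : ∀ {i j} → punched i ≡ punched j → i ≡ j
  punched-injective {i} {j} e =
    x-inj i j (FinP.punchOut-injective (λ v≡xi → missed (i , sym v≡xi))
                                       (λ v≡xj → missed (j , sym v≡xj)) e)

-- Junk value: v itself when v does not occur in x (impossible for permutations).
pos : Word n → Fin n → Fin n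
pos x v with FinP.any? (λ i → lookup x i ≟ v)
... | yes (i , _) = i
... | no _ = v

lookup-pos : (x : Word n) → IsPerm x → ∀ v → lookup x (pos x v) ≡ v
lookup-pos x x-inj v with FinP.any? (λ i → lookup x i ≟ v)
... | yes (_ , xi≡v) = xi≡v
... | no missed = contradiction (perm-surjective x x-inj v) missed

pos-lookup : (x : Word n) → IsPerm x → ∀ i → pos x (lookup x i) ≡ i
pos-lookup x x-inj i = x-inj _ i (lookup-pos x x-inj _)

pos-injective : (x : Word n) → IsPerm x → ∀ u v → pos x u ≡ pos x v → u ≡ v
pos-injective x x-inj u v e =
  trans (sym (lookup-pos x x-inj u)) (trans (cong (lookup x) e) (lookup-pos x x-inj v))

map-perm-injective : {A : Set} (x : Word n) → IsPerm x → (f g : Fin n → A) →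
                     map f x ≡ map g x → ∀ v → f v ≡ g v
map-perm-injective x x-inj f g fx≡gx v with perm-surjective x x-inj v
... | i , refl = begin
  f (lookup x i)     ≡⟨ VecP.lookup-map i f x ⟨
  lookup (map f x) i ≡⟨ cong (λ y → lookup y i) fx≡gx ⟩
  lookup (map g x) i ≡⟨ VecP.lookup-map i g x ⟩
  g (lookup x i)     ∎
  where open ≡-Reasoning

swap-perm : (a b : Fin n) (x : Word n) → IsPerm x → IsPerm (map (swapFin a b) x)
swap-perm a b x x-inj i j e = x-inj i j (swapFin-injective a b (begin
  swapFin a b (lookup x i)        ≡⟨ VecP.lookup-map i (swapFin a b) x ⟨
  lookup (map (swapFin a b) x) i  ≡⟨ e ⟩
  lookup (map (swapFin a b) x) j  ≡⟨ VecP.lookup-map j (swapFin a b) x ⟩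
  swapFin a b (lookup x j)        ∎))
  where open ≡-Reasoning

pos-swap : (a b : Fin n) (x : Word n) → IsPerm x → ∀ k →
           pos (map (swapFin a b) x) k ≡ pos x (swapFin a b k)
pos-swap a b x x-inj k = swap-perm a b x x-inj _ _ (begin
  lookup (map (swapFin a b) x) (pos (map (swapFin a b) x) k)
    ≡⟨ lookup-pos (map (swapFin a b) x) (swap-perm a b x x-inj) k ⟩
  k
    ≡⟨ swapFin-involutive a b k ⟨
  swapFin a b (swapFin a b k)
    ≡⟨ cong (swapFin a b) (lookup-pos x x-inj _) ⟨
  swapFin a b (lookup x (pos x (swapFin a b k)))
    ≡⟨ VecP.lookup-map _ (swapFin a b) x ⟨
  lookup (map (swapFin a b) x) (pos x (swapFin a b k)) ∎)
  where open ≡-Reasoning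

swap-values≗swap-positions : (x : Word n) → IsPerm x → ∀ i →
  lookup (map (swapFin a b) x) i ≡ lookup x (swapFin (pos x b) (pos x a) i)
swap-values≗swap-positions {a = a} {b = b} x x-inj i with swapFin-cases (pos x b) (pos x a) i
... | inj₁ (refl , e) = begin
  lookup (map (swapFin a b) x) (pos x b)  ≡⟨ VecP.lookup-map (pos x b) (swapFin a b) x ⟩
  swapFin a b (lookup x (pos x b))        ≡⟨ cong (swapFin a b) (lookup-pos x x-inj b) ⟩
  swapFin a b b                           ≡⟨ swapFin-right a b ⟩
  a                                       ≡⟨ lookup-pos x x-inj a ⟨
  lookup x (pos x a)                      ≡⟨ cong (lookup x) e ⟨
  lookup x (swapFin (pos x b) (pos x a) (pos x b)) ∎
  where open ≡-Reasoning
... | inj₂ (inj₁ (refl , e)) = begin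
  lookup (map (swapFin a b) x) (pos x a)  ≡⟨ VecP.lookup-map (pos x a) (swapFin a b) x ⟩
  swapFin a b (lookup x (pos x a))        ≡⟨ cong (swapFin a b) (lookup-pos x x-inj a) ⟩
  swapFin a b a                           ≡⟨ swapFin-left a b ⟩
  b                                       ≡⟨ lookup-pos x x-inj b ⟨
  lookup x (pos x b)                      ≡⟨ cong (lookup x) e ⟨
  lookup x (swapFin (pos x b) (pos x a) (pos x a)) ∎
  where open ≡-Reasoning
... | inj₂ (inj₂ (i≢pb , i≢pa , e)) = begin
  lookup (map (swapFin a b) x) i  ≡⟨ VecP.lookup-map i (swapFin a b) x ⟩
  swapFin a b (lookup x i)        ≡⟨ swapFin-other a b (i≢pa ∘ at-pos) (i≢pb ∘ at-pos) ⟩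
  lookup x i                      ≡⟨ cong (lookup x) e ⟨
  lookup x (swapFin (pos x b) (pos x a) i) ∎
  where
  open ≡-Reasoning
  at-pos : ∀ {v} → lookup x i ≡ v → i ≡ pos x v
  at-pos xi≡v = trans (sym (pos-lookup x x-inj i)) (cong (pos x) xi≡v)

-- Bruhat edges and short paths

edge-target : BEdge x t y → y ≡ map ⟦ t ⟧ x
edge-target = proj₁ ∘ proj₂

edge-len : BEdge x t y → len x ℕ.< len y
edge-len = proj₂ ∘ proj₂

edge-perm : IsPerm x → BEdge x t y → IsPerm y
edge-perm {x = x} {t = a , b} x-inj (_ , refl , _) = swap-perm a b x x-inj

Adjacent : Word n → Word n → Set
Adjacent x y = ∃₂ λ a b → a < b × y ≡ map (swapFin a b) x

edge-adjacent : BEdge x t y → Adjacent x y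
edge-adjacent {t = a , b} (a<b , y≡ , _) = a , b , a<b , y≡

_≟ᵂ_ : (x y : Word n) → Dec (x ≡ y)
_≟ᵂ_ = VecP.≡-dec _≟_

adjacent? : (x y : Word n) → Dec (Adjacent x y)
adjacent? x y = FinP.any? λ a → FinP.any? λ b → (a <? b) ×-dec (y ≟ᵂ map (swapFin a b) x)

≢-by-len : len x ℕ.< len y → y ≢ x
≢-by-len ℓx<ℓy refl = ℕP.<-irrefl refl ℓx<ℓy

map-⟦⟧-involutive : (t : Transp n) (x : Word n) → map ⟦ t ⟧ (map ⟦ t ⟧ x) ≡ x
map-⟦⟧-involutive t x = trans (sym (VecP.map-∘ ⟦ t ⟧ ⟦ t ⟧ x))
                               (trans (VecP.map-cong (⟦⟧-involutive t) x) (VecP.map-id x))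

consecutive-labels-differ : BEdge x₀ s x₁ → BEdge x₁ t x₂ → s ≢ t
consecutive-labels-differ {x₀ = x₀} {s = s} {x₁ = x₁} {x₂ = x₂} e₁ e₂ refl =
  ℕP.<-asym (edge-len e₁) (subst (λ y → len x₁ ℕ.< len y) x₂≡x₀ (edge-len e₂))
  where
  x₂≡x₀ : x₂ ≡ x₀
  x₂≡x₀ = trans (edge-target e₂)
                (trans (cong (map ⟦ s ⟧) (edge-target e₁)) (map-⟦⟧-involutive s x₀))

edges-compose : BEdge x₀ α x₁ → BEdge x₁ β x₂ → x₂ ≡ map (⟦ β ⟧ ∘ ⟦ α ⟧) x₀
edges-compose {x₀ = x₀} {α = α} {β = β} e₁ e₂ =
  trans (edge-target e₂)
        (trans (cong (map ⟦ β ⟧) (edge-target e₁)) (sym (VecP.map-∘ ⟦ β ⟧ ⟦ α ⟧ x₀)))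

two-step-product : (x₀ : Word n) → IsPerm x₀ → BEdge x₀ α x₁ → BEdge x₁ β x₂ →
                   x₂ ≡ map ⟦ τ ⟧ x₀ → ∀ k → ⟦ β ⟧ (⟦ α ⟧ k) ≡ ⟦ τ ⟧ k
two-step-product {α = α} {β = β} {τ = τ} x₀ x₀-inj e₁ e₂ x₂≡τx₀ =
  map-perm-injective x₀ x₀-inj (⟦ β ⟧ ∘ ⟦ α ⟧) ⟦ τ ⟧ (trans (sym (edges-compose e₁ e₂)) x₂≡τx₀)

three-step-product : (x₀ : Word n) → IsPerm x₀ → BEdge x₀ α x₁ → BEdge x₁ β x₂ → BEdge x₂ γ x₃ →
                     x₃ ≡ map ⟦ τ ⟧ x₀ → ∀ k → ⟦ γ ⟧ (⟦ β ⟧ (⟦ α ⟧ k)) ≡ ⟦ τ ⟧ k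
three-step-product {α = α} {β = β} {x₂ = x₂} {γ = γ} {x₃ = x₃} {τ = τ} x₀ x₀-inj e₁ e₂ e₃ x₃≡τx₀ =
  map-perm-injective x₀ x₀-inj (⟦ γ ⟧ ∘ ⟦ β ⟧ ∘ ⟦ α ⟧) ⟦ τ ⟧ (begin
    map (⟦ γ ⟧ ∘ ⟦ β ⟧ ∘ ⟦ α ⟧) x₀     ≡⟨ VecP.map-∘ ⟦ γ ⟧ (⟦ β ⟧ ∘ ⟦ α ⟧) x₀ ⟩
    map ⟦ γ ⟧ (map (⟦ β ⟧ ∘ ⟦ α ⟧) x₀)  ≡⟨ cong (map ⟦ γ ⟧) (edges-compose e₁ e₂) ⟨
    map ⟦ γ ⟧ x₂                       ≡⟨ edge-target e₃ ⟨
    x₃                                 ≡⟨ x₃≡τx₀ ⟩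
    map ⟦ τ ⟧ x₀                       ∎)
  where open ≡-Reasoning

two-steps-not-adjacent : IsPerm x₀ → BEdge x₀ α x₁ → BEdge x₁ β x₂ → ¬ Adjacent x₀ x₂
two-steps-not-adjacent {x₀ = x₀} x₀-inj e₁ e₂ (a , b , a<b , x₂≡) =
  product-not-transp (proj₁ e₁) (proj₁ e₂) a<b (consecutive-labels-differ e₁ e₂)
    (two-step-product {τ = a , b} x₀ x₀-inj e₁ e₂ x₂≡)

-- Counting inversions

ind : Bool → ℕ
ind b = if b then 1 else 0

does-mono : {A B : Set} → (A → B) → (a? : Dec A) (b? : Dec B) → does a? Bool.≤ does b?
does-mono _ (yes _) (yes _) = b≤b
does-mono A→B (yes a) (no ¬b) = contradiction (A→B a) ¬b
does-mono _ (no _) (yes _) = f≤t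
does-mono _ (no _) (no _) = b≤b

∧-rearrangement : ∀ {p q r s} → p Bool.≤ q → s Bool.≤ r →
                  ind (p ∧ r) + ind (q ∧ s) ℕ.≤ ind (q ∧ r) + ind (p ∧ s)
∧-rearrangement b≤b _ = ℕP.≤-refl
∧-rearrangement f≤t (b≤b {false}) = z≤n
∧-rearrangement f≤t (b≤b {true}) = s≤s z≤n
∧-rearrangement f≤t f≤t = z≤n

ind-∧-noˡ : {A : Set} (a? : Dec A) → ¬ A → ∀ b → ind (does a? ∧ b) ≡ 0
ind-∧-noˡ a? ¬a b rewrite dec-false a? ¬a = refl

ind-∧-noʳ : {B : Set} (b? : Dec B) → ¬ B → ∀ a → ind (a ∧ does b?) ≡ 0
ind-∧-noʳ b? ¬b false = refl
ind-∧-noʳ b? ¬b true rewrite dec-false b? ¬b = refl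

listSum-allFin : (f : Fin n → ℕ) → ListSum.sum (List.map f (allFin n)) ≡ sum f
listSum-allFin f = trans (cong ListSum.sum (ListP.map-tabulate (λ i → i) f)) (listSum-tabulate f)
  where
  listSum-tabulate : ∀ {m} (g : Fin m → ℕ) → ListSum.sum (List.tabulate g) ≡ sum g
  listSum-tabulate {zero} g = refl
  listSum-tabulate {suc m} g = cong (g Fin.zero +_) (listSum-tabulate (g ∘ Fin.suc))

∑-swap : (P Q : Fin n) (g : Fin n → ℕ) → sum (g ∘ swapFin P Q) ≡ sum g
∑-swap P Q g =
  sym (trans (∑-permute g (Perm.transpose P Q)) (sum-cong-≗ (cong g ∘ transpose≗swapFin)))
  where
  transpose≗swapFin : ∀ k → Perm.transpose P Q Perm.⟨$⟩ʳ k ≡ swapFin P Q k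
  transpose≗swapFin k with k ≟ P
  ... | yes _ = refl
  ... | no _ with k ≟ Q
  ...   | yes _ = refl
  ...   | no _ = refl

∑-mono : {f g : Fin n → ℕ} → (∀ i → f i ℕ.≤ g i) → sum f ℕ.≤ sum g
∑-mono {zero} _ = z≤n
∑-mono {suc n} f≤g = ℕP.+-mono-≤ (f≤g Fin.zero) (∑-mono (f≤g ∘ Fin.suc))

∑-mono-except : {f g : Fin n → ℕ} {k l : ℕ} (Q : Fin n) → k + f Q ℕ.≤ l + g Q →
                (∀ i → i ≢ Q → f i ℕ.≤ g i) → k + sum f ℕ.≤ l + sum g
∑-mono-except {f = f} {g} {k} {l} Fin.zero at-Q elsewhere = begin
  k + (f Fin.zero + sum (f ∘ Fin.suc))   ≡⟨ ℕP.+-assoc k _ _ ⟨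
  k + f Fin.zero + sum (f ∘ Fin.suc)     ≤⟨ ℕP.+-mono-≤ at-Q (∑-mono λ i → elsewhere (Fin.suc i) λ ()) ⟩
  l + g Fin.zero + sum (g ∘ Fin.suc)     ≡⟨ ℕP.+-assoc l _ _ ⟩
  l + (g Fin.zero + sum (g ∘ Fin.suc))   ∎
  where open ℕP.≤-Reasoning
∑-mono-except {f = f} {g} {k} {l} (Fin.suc Q) at-Q elsewhere = begin
  k + (f Fin.zero + sum (f ∘ Fin.suc))   ≡⟨ x∙yz≈y∙xz k (f Fin.zero) (sum (f ∘ Fin.suc)) ⟩
  f Fin.zero + (k + sum (f ∘ Fin.suc))
    ≤⟨ ℕP.+-mono-≤ (elsewhere Fin.zero λ ())
                   (∑-mono-except Q at-Q λ i i≢Q →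
                      elsewhere (Fin.suc i) (i≢Q ∘ FinP.suc-injective)) ⟩
  g Fin.zero + (l + sum (g ∘ Fin.suc))   ≡⟨ x∙yz≈y∙xz (g Fin.zero) l (sum (g ∘ Fin.suc)) ⟩
  l + (g Fin.zero + sum (g ∘ Fin.suc))   ∎
  where open ℕP.≤-Reasoning

∑-mono-pair : {f g : Fin n → ℕ} (P Q : Fin n) → P ≢ Q → f P + f Q ℕ.≤ g P + g Q →
              (∀ i → i ≢ P → i ≢ Q → f i ℕ.≤ g i) → sum f ℕ.≤ sum g
∑-mono-pair Fin.zero Fin.zero P≢Q _ _ = contradiction refl P≢Q
∑-mono-pair Fin.zero (Fin.suc Q) _ at-PQ elsewhere =
  ∑-mono-except Q at-PQ λ i i≢Q → elsewhere (Fin.suc i) (λ ()) (i≢Q ∘ FinP.suc-injective)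
∑-mono-pair {f = f} {g} (Fin.suc P) Fin.zero _ at-PQ elsewhere =
  ∑-mono-except P (subst₂ ℕ._≤_ (ℕP.+-comm (f (Fin.suc P)) _) (ℕP.+-comm (g (Fin.suc P)) _) at-PQ)
    λ i i≢P → elsewhere (Fin.suc i) (i≢P ∘ FinP.suc-injective) (λ ())
∑-mono-pair (Fin.suc P) (Fin.suc Q) P≢Q at-PQ elsewhere =
  ℕP.+-mono-≤ (elsewhere Fin.zero (λ ()) (λ ()))
    (∑-mono-pair P Q (P≢Q ∘ cong Fin.suc) at-PQ λ i i≢P i≢Q →
      elsewhere (Fin.suc i) (i≢P ∘ FinP.suc-injective) (i≢Q ∘ FinP.suc-injective))

inv : (Fin n → Fin n) → Fin n → Fin n → ℕ
inv f i j = ind (does (i <? j) ∧ does (f j <? f i))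

∑inv : (Fin n → Fin n) → ℕ
∑inv f = sum λ i → sum λ j → inv f i j

len≡∑inv : (x : Word n) → len x ≡ ∑inv (lookup x)
len≡∑inv {n} x = trans (listSum-allFin λ i → ListSum.sum (List.map (inv (lookup x) i) (allFin n)))
                        (sum-cong-≗ λ i → listSum-allFin (inv (lookup x) i))

∑inv-cong : {f g : Fin n → Fin n} → (∀ i → f i ≡ g i) → ∑inv f ≡ ∑inv g
∑inv-cong f≗g = sum-cong-≗ λ i → sum-cong-≗ λ j →
  cong₂ (λ u v → ind (does (i <? j) ∧ does (u <? v))) (f≗g j) (f≗g i)

module _ (f : Fin n → Fin n) {P Q : Fin n} (P<Q : P < Q) (fQ<fP : f Q < f P) where

  private
    P≢Q : P ≢ Q
    P≢Q = FinP.<⇒≢ P<Q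

    swapped : Fin n → Fin n → ℕ
    swapped i j = ind (does (swapFin P Q i <? swapFin P Q j) ∧ does (f j <? f i))

    swapped-at : ∀ {i j i′ j′} → swapFin P Q i ≡ i′ → swapFin P Q j ≡ j′ →
                 swapped i j ≡ ind (does (i′ <? j′) ∧ does (f j <? f i))
    swapped-at refl refl = refl

    vanishes : ∀ {i j l} → i ≡ 0 → j ≡ 0 → i + j ℕ.≤ l
    vanishes refl refl = z≤n

    Column : Fin n → Set
    Column j = swapped P j + swapped Q j ℕ.≤ inv f P j + inv f Q j

    column-P : Column P
    column-P = vanishes
      (ind-∧-noˡ (swapFin P Q P <? swapFin P Q P) (FinP.<-irrefl refl) _)
      (trans (swapped-at (swapFin-right P Q) (swapFin-left P Q))
             (ind-∧-noʳ (f P <? f Q) (FinP.<-asym fQ<fP) _))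

    column-Q : Column Q
    column-Q = vanishes
      (trans (swapped-at (swapFin-left P Q) (swapFin-right P Q))
             (ind-∧-noˡ (Q <? P) (FinP.<-asym P<Q) _))
      (ind-∧-noˡ (swapFin P Q Q <? swapFin P Q Q) (FinP.<-irrefl refl) _)

    column-other : ∀ j → j ≢ P → j ≢ Q → Column j
    column-other j j≢P j≢Q =
      subst₂ (λ i l → i + l ℕ.≤ inv f P j + inv f Q j)
        (sym (swapped-at (swapFin-left P Q) (swapFin-other P Q j≢P j≢Q)))
        (sym (swapped-at (swapFin-right P Q) (swapFin-other P Q j≢P j≢Q)))
        (∧-rearrangement (does-mono (FinP.<-trans P<Q) (Q <? j) (P <? j))
                         (does-mono (λ fj<fQ → FinP.<-trans fj<fQ fQ<fP) (f j <? f Q) (f j <? f P)))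

    column : ∀ j → Column j
    column j = by-cases (j ≟ P) (j ≟ Q)
      where
      by-cases : Dec (j ≡ P) → Dec (j ≡ Q) → Column j
      by-cases (yes j≡P) _ = subst Column (sym j≡P) column-P
      by-cases (no _) (yes j≡Q) = subst Column (sym j≡Q) column-Q
      by-cases (no j≢P) (no j≢Q) = column-other j j≢P j≢Q

    rows-PQ : sum (swapped P) + sum (swapped Q) ℕ.≤ sum (inv f P) + sum (inv f Q)
    rows-PQ = begin
      sum (swapped P) + sum (swapped Q)        ≡⟨ ∑-distrib-+ (swapped P) (swapped Q) ⟨
      sum (λ j → swapped P j + swapped Q j)    ≤⟨ ∑-mono column ⟩
      sum (λ j → inv f P j + inv f Q j)        ≡⟨ ∑-distrib-+ (inv f P) (inv f Q) ⟩
      sum (inv f P) + sum (inv f Q)            ∎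
      where open ℕP.≤-Reasoning

    columns-PQ-in-row : ∀ i → i ≢ P → i ≢ Q →
                        swapped i P + swapped i Q ℕ.≤ inv f i P + inv f i Q
    columns-PQ-in-row i i≢P i≢Q = begin
      swapped i P + swapped i Q
        ≡⟨ cong₂ _+_ (swapped-at {i} {P} (swapFin-other P Q i≢P i≢Q) (swapFin-left P Q))
                     (swapped-at {i} {Q} (swapFin-other P Q i≢P i≢Q) (swapFin-right P Q)) ⟩
      ind (does (i <? Q) ∧ does (f P <? f i)) + ind (does (i <? P) ∧ does (f Q <? f i))
        ≡⟨ ℕP.+-comm (ind (does (i <? Q) ∧ does (f P <? f i))) _ ⟩
      ind (does (i <? P) ∧ does (f Q <? f i)) + ind (does (i <? Q) ∧ does (f P <? f i))
        ≤⟨ ∧-rearrangement (does-mono (λ i<P → FinP.<-trans i<P P<Q) (i <? P) (i <? Q))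
                           (does-mono (FinP.<-trans fQ<fP) (f P <? f i) (f Q <? f i)) ⟩
      inv f i Q + inv f i P
        ≡⟨ ℕP.+-comm (inv f i Q) (inv f i P) ⟩
      inv f i P + inv f i Q ∎
      where open ℕP.≤-Reasoning

    other-row : ∀ i → i ≢ P → i ≢ Q → sum (swapped i) ℕ.≤ sum (inv f i)
    other-row i i≢P i≢Q = ∑-mono-pair P Q P≢Q (columns-PQ-in-row i i≢P i≢Q) λ j j≢P j≢Q →
      ℕP.≤-reflexive (swapped-at (swapFin-other P Q i≢P i≢Q) (swapFin-other P Q j≢P j≢Q))

  -- Reindexed by (P Q), the inversions of f ∘ (P Q) are counted by swapped; rows P and Q
  -- together, and every other row, are dominated by those of f (∧-rearrangement).
  ∑inv-swap-inversion : ∑inv (f ∘ swapFin P Q) ℕ.≤ ∑inv f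
  ∑inv-swap-inversion = begin
    ∑inv (f ∘ swapFin P Q)
      ≡⟨ sym (∑-swap P Q λ i → sum λ j → inv (f ∘ swapFin P Q) i j) ⟩
    sum (λ i → sum λ j → inv (f ∘ swapFin P Q) (swapFin P Q i) j)
      ≡⟨ sum-cong-≗ (λ i → sym (∑-swap P Q (inv (f ∘ swapFin P Q) (swapFin P Q i)))) ⟩
    sum (λ i → sum λ j → inv (f ∘ swapFin P Q) (swapFin P Q i) (swapFin P Q j))
      ≡⟨ sum-cong-≗ (λ i → sum-cong-≗ λ j →
           cong₂ (λ i′ j′ → ind (does (swapFin P Q i <? swapFin P Q j) ∧ does (f i′ <? f j′)))
                 (swapFin-involutive P Q j) (swapFin-involutive P Q i)) ⟩
    sum (λ i → sum (swapped i))
      ≤⟨ ∑-mono-pair P Q P≢Q rows-PQ other-row ⟩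
    ∑inv f ∎
    where open ℕP.≤-Reasoning

edge-order : (x : Word n) → IsPerm x → BEdge x (a , b) y → pos x a < pos x b
edge-order {a = a} {b = b} x x-inj (a<b , refl , ℓx<ℓy) with FinP.<-cmp (pos x a) (pos x b)
... | tri< before _ _ = before
... | tri≈ _ same _ = contradiction (pos-injective x x-inj a b same) (FinP.<⇒≢ a<b)
... | tri> _ _ after = contradiction len-y≤len-x (ℕP.<⇒≱ ℓx<ℓy)
  where
  inversion : lookup x (pos x a) < lookup x (pos x b)
  inversion = subst₂ _<_ (sym (lookup-pos x x-inj a)) (sym (lookup-pos x x-inj b)) a<b
  len-y≤len-x : len (map (swapFin a b) x) ℕ.≤ len x
  len-y≤len-x = begin
    len (map (swapFin a b) x)                      ≡⟨ len≡∑inv (map (swapFin a b) x) ⟩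
    ∑inv (lookup (map (swapFin a b) x))            ≡⟨ ∑inv-cong (swap-values≗swap-positions x x-inj) ⟩
    ∑inv (lookup x ∘ swapFin (pos x b) (pos x a))  ≤⟨ ∑inv-swap-inversion (lookup x) after inversion ⟩
    ∑inv (lookup x)                                ≡⟨ len≡∑inv x ⟨
    len x                                          ∎
    where open ℕP.≤-Reasoning

-- Inversions within a triple of values

inverted : Word n → Fin n → Fin n → ℕ
inverted x u w = ind (does (u <? w) xor does (pos x u <? pos x w))

inverted-at : pos x u ≡ m → pos x w ≡ k → inverted x u w ≡ ind (does (u <? w) xor does (m <? k))
inverted-at refl refl = refl

does-flip : (u w : Fin n) → u ≢ w → does (w <? u) ≡ not (does (u <? w))
does-flip u w u≢w with FinP.<-cmp u w
... | tri< u<w _ _ rewrite dec-true (u <? w) u<w | dec-false (w <? u) (FinP.<-asym u<w) = refl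
... | tri≈ _ u≡w _ = contradiction u≡w u≢w
... | tri> _ _ w<u rewrite dec-false (u <? w) (FinP.<-asym w<u) | dec-true (w <? u) w<u = refl

inverted-sym : (x : Word n) → IsPerm x → u ≢ w → inverted x u w ≡ inverted x w u
inverted-sym {u = u} {w = w} x x-inj u≢w =
  cong ind (trans (not-xor-not (does (u <? w)) (does (pos x u <? pos x w)))
                  (sym (cong₂ _xor_ (does-flip u w u≢w)
                                    (does-flip (pos x u) (pos x w)
                                               (u≢w ∘ pos-injective x x-inj u w)))))
  where
  not-xor-not : ∀ p q → p xor q ≡ not p xor not q
  not-xor-not false q = sym (BoolP.not-involutive q)
  not-xor-not true q = refl

ind≤1 : ∀ p → ind p ℕ.≤ 1
ind≤1 false = z≤n
ind≤1 true = s≤s z≤n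

inverted≤1 : (x : Word n) (u w : Fin n) → inverted x u w ℕ.≤ 1
inverted≤1 x u w = ind≤1 (does (u <? w) xor does (pos x u <? pos x w))

xor-rearrangement : ∀ {p q r s} → q Bool.≤ p → s Bool.≤ r →
                    ind (p xor r) + ind (q xor s) ℕ.≤ ind (p xor s) + ind (q xor r)
xor-rearrangement b≤b b≤b = ℕP.≤-refl
xor-rearrangement (b≤b {false}) f≤t = s≤s z≤n
xor-rearrangement (b≤b {true}) f≤t = s≤s z≤n
xor-rearrangement f≤t b≤b = ℕP.≤-refl
xor-rearrangement f≤t f≤t = z≤n

ℓ₃ : Word n → Fin n → Fin n → Fin n → ℕ
ℓ₃ x u v w = inverted x u v + inverted x u w + inverted x v w

ℓ₃≤3 : (x : Word n) (u v w : Fin n) → ℓ₃ x u v w ℕ.≤ 3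
ℓ₃≤3 x u v w = ℕP.+-mono-≤ (ℕP.+-mono-≤ (inverted≤1 x u v) (inverted≤1 x u w)) (inverted≤1 x v w)

-- Along an edge with label (a , b) the pair {a, b} becomes inverted, and the
-- pairs {a, k}, {b, k} lose no inversions (xor-rearrangement).
edge-inverts : (x : Word n) → IsPerm x → BEdge x (a , b) y → k ≢ a → k ≢ b →
               suc (ℓ₃ x a b k) ℕ.≤ ℓ₃ y a b k
edge-inverts {n} {a = a} {b = b} {k = k} x x-inj e@(a<b , refl , _) k≢a k≢b = begin
  suc (ℓ₃ x a b k)
    ≡⟨ cong (λ i → suc (i + inverted x a k + inverted x b k)) ab-before ⟩
  suc (ind (does (a <? k) xor does (A <? K)) + ind (does (b <? k) xor does (B <? K)))
    ≤⟨ s≤s (xor-rearrangement (does-mono (FinP.<-trans a<b) (b <? k) (a <? k))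
                              (does-mono (FinP.<-trans A<B) (B <? K) (A <? K))) ⟩
  suc (ind (does (a <? k) xor does (B <? K)) + ind (does (b <? k) xor does (A <? K)))
    ≡⟨ cong₂ _+_ (cong₂ _+_ ab-after (inverted-at pos-a pos-k)) (inverted-at pos-b pos-k) ⟨
  ℓ₃ y′ a b k ∎
  where
  open ℕP.≤-Reasoning
  y′ : Word n
  y′ = map (swapFin a b) x
  A B K : Fin n
  A = pos x a
  B = pos x b
  K = pos x k
  A<B : A < B
  A<B = edge-order x x-inj e
  pos-a : pos y′ a ≡ B
  pos-a = trans (pos-swap a b x x-inj a) (cong (pos x) (swapFin-left a b))
  pos-b : pos y′ b ≡ A
  pos-b = trans (pos-swap a b x x-inj b) (cong (pos x) (swapFin-right a b))
  pos-k : pos y′ k ≡ K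
  pos-k = trans (pos-swap a b x x-inj k) (cong (pos x) (swapFin-other a b k≢a k≢b))
  ab-before : inverted x a b ≡ 0
  ab-before rewrite dec-true (a <? b) a<b | dec-true (A <? B) A<B = refl
  ab-after : inverted y′ a b ≡ 1
  ab-after rewrite inverted-at pos-a pos-b | dec-true (a <? b) a<b
                 | dec-false (B <? A) (FinP.<-asym A<B) = refl

Distinct₃ : Fin n → Fin n → Fin n → Set
Distinct₃ u v w = u ≢ v × u ≢ w × v ≢ w

ℓ₃-swap₁₂ : (x : Word n) → IsPerm x → u ≢ v → ℓ₃ x u v w ≡ ℓ₃ x v u w
ℓ₃-swap₁₂ {u = u} {v = v} {w = w} x x-inj u≢v = begin
  inverted x u v + inverted x u w + inverted x v w
    ≡⟨ cong (λ i → i + inverted x u w + inverted x v w) (inverted-sym x x-inj u≢v) ⟩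
  inverted x v u + inverted x u w + inverted x v w
    ≡⟨ xy∙z≈xz∙y (inverted x v u) (inverted x u w) (inverted x v w) ⟩
  inverted x v u + inverted x v w + inverted x u w ∎
  where open ≡-Reasoning

ℓ₃-swap₂₃ : (x : Word n) → IsPerm x → v ≢ w → ℓ₃ x u v w ≡ ℓ₃ x u w v
ℓ₃-swap₂₃ {v = v} {w = w} {u = u} x x-inj v≢w =
  cong₂ _+_ (ℕP.+-comm (inverted x u v) (inverted x u w)) (inverted-sym x x-inj v≢w)

Grows : Word n → Word n → Fin n → Fin n → Fin n → Set
Grows x y u v w = suc (ℓ₃ x u v w) ℕ.≤ ℓ₃ y u v w

grows-swap₁₂ : IsPerm x → IsPerm y → u ≢ v → Grows x y u v w → Grows x y v u w
grows-swap₁₂ {x = x} {y = y} {w = w} x-inj y-inj u≢v =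
  subst₂ (λ i j → suc i ℕ.≤ j) (ℓ₃-swap₁₂ {w = w} x x-inj u≢v) (ℓ₃-swap₁₂ {w = w} y y-inj u≢v)

grows-swap₂₃ : IsPerm x → IsPerm y → v ≢ w → Grows x y u v w → Grows x y u w v
grows-swap₂₃ {x = x} {y = y} {u = u} x-inj y-inj v≢w =
  subst₂ (λ i j → suc i ℕ.≤ j) (ℓ₃-swap₂₃ {u = u} x x-inj v≢w) (ℓ₃-swap₂₃ {u = u} y y-inj v≢w)

edge-within-triple : (x : Word n) → IsPerm x → BEdge x t y → Distinct₃ u v w →
                     supp t ⊆ u ∷ᴸ v ∷ᴸ w ∷ᴸ []ᴸ → Grows x y u v w
edge-within-triple {t = a , b} {u = u} {v = v} {w = w} x x-inj e@(a<b , _ , _)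
                   (u≢v , u≢w , v≢w) t⊆uvw
  with t⊆uvw (here refl) | t⊆uvw (there (here refl)) | edge-perm x-inj e
... | here refl | here refl | _ = contradiction refl (FinP.<⇒≢ a<b)
... | here refl | there (here refl) | _ = edge-inverts x x-inj e (u≢w ∘ sym) (v≢w ∘ sym)
... | here refl | there (there (here refl)) | y-inj =
  grows-swap₂₃ {u = u} x-inj y-inj (v≢w ∘ sym) (edge-inverts x x-inj e (u≢v ∘ sym) v≢w)
... | there (here refl) | here refl | y-inj =
  grows-swap₁₂ {w = w} x-inj y-inj (u≢v ∘ sym) (edge-inverts x x-inj e (v≢w ∘ sym) (u≢w ∘ sym))
... | there (here refl) | there (here refl) | _ = contradiction refl (FinP.<⇒≢ a<b)
... | there (here refl) | there (there (here refl)) | y-inj =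
  grows-swap₁₂ {w = w} x-inj y-inj (u≢v ∘ sym)
    (grows-swap₂₃ {u = v} x-inj y-inj (u≢w ∘ sym) (edge-inverts x x-inj e u≢v u≢w))
... | there (there (here refl)) | here refl | y-inj =
  grows-swap₂₃ {u = u} x-inj y-inj (v≢w ∘ sym)
    (grows-swap₁₂ {w = v} x-inj y-inj (u≢w ∘ sym) (edge-inverts x x-inj e v≢w (u≢v ∘ sym)))
... | there (there (here refl)) | there (here refl) | y-inj =
  grows-swap₁₂ {w = w} x-inj y-inj (u≢v ∘ sym)
    (grows-swap₂₃ {u = v} x-inj y-inj (u≢w ∘ sym)
      (grows-swap₁₂ {w = u} x-inj y-inj (v≢w ∘ sym) (edge-inverts x x-inj e u≢w u≢v)))
... | there (there (here refl)) | there (there (here refl)) | _ = contradiction refl (FinP.<⇒≢ a<b)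

-- Each step raises ℓ₃ ≤ 3 by at least one.
three-steps-within-triple : (x₀ : Word n) → IsPerm x₀ →
  BEdge x₀ α x₁ → BEdge x₁ β x₂ → BEdge x₂ γ x₃ → Distinct₃ u v w →
  supp α ⊆ u ∷ᴸ v ∷ᴸ w ∷ᴸ []ᴸ → supp β ⊆ u ∷ᴸ v ∷ᴸ w ∷ᴸ []ᴸ → supp γ ⊆ u ∷ᴸ v ∷ᴸ w ∷ᴸ []ᴸ →
  ℓ₃ x₀ u v w ≡ 0 × ℓ₃ x₃ u v w ≡ 3
three-steps-within-triple {x₁ = x₁} {x₂ = x₂} {x₃ = x₃} {u = u} {v = v} {w = w}
                          x₀ x₀-inj e₁ e₂ e₃ uvw α⊆ β⊆ γ⊆ =
  ℕP.n≤0⇒n≡0 (ℕP.+-cancelˡ-≤ 3 _ 0 (ℕP.≤-trans climb (ℓ₃≤3 x₃ u v w))) ,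
  ℕP.≤-antisym (ℓ₃≤3 x₃ u v w) (ℕP.≤-trans (ℕP.m≤m+n 3 _) climb)
  where
  climb : 3 + ℓ₃ x₀ u v w ℕ.≤ ℓ₃ x₃ u v w
  climb = ℕP.≤-trans (s≤s (s≤s (edge-within-triple x₀ x₀-inj e₁ uvw α⊆)))
            (ℕP.≤-trans (s≤s (edge-within-triple x₁ (edge-perm x₀-inj e₁) e₂ uvw β⊆))
                        (edge-within-triple x₂ (edge-perm (edge-perm x₀-inj e₁) e₂) e₃ uvw γ⊆))

bits≡3 : ∀ {i j l} → i ℕ.≤ 1 → j ℕ.≤ 1 → l ℕ.≤ 1 → i + j + l ≡ 3 → i ≡ 1 × j ≡ 1 × l ≡ 1
bits≡3 (s≤s z≤n) (s≤s z≤n) (s≤s z≤n) _ = refl , refl , refl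
bits≡3 z≤n z≤n z≤n ()
bits≡3 z≤n z≤n (s≤s z≤n) ()
bits≡3 z≤n (s≤s z≤n) z≤n ()
bits≡3 z≤n (s≤s z≤n) (s≤s z≤n) ()
bits≡3 (s≤s z≤n) z≤n z≤n ()
bits≡3 (s≤s z≤n) z≤n (s≤s z≤n) ()
bits≡3 (s≤s z≤n) (s≤s z≤n) z≤n ()

ℓ₃≡3⇒inverted : (x : Word n) → IsPerm x → ℓ₃ x u v w ≡ 3 →
  m ∈ u ∷ᴸ v ∷ᴸ w ∷ᴸ []ᴸ → k ∈ u ∷ᴸ v ∷ᴸ w ∷ᴸ []ᴸ → m ≢ k → inverted x m k ≡ 1
ℓ₃≡3⇒inverted {u = u} {v = v} {w = w} x x-inj ℓ≡3 m∈ k∈ m≢k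
  with bits≡3 (inverted≤1 x u v) (inverted≤1 x u w) (inverted≤1 x v w) ℓ≡3 | m∈ | k∈
... | _ | here refl | here refl = contradiction refl m≢k
... | uv , _ , _ | here refl | there (here refl) = uv
... | _ , uw , _ | here refl | there (there (here refl)) = uw
... | uv , _ , _ | there (here refl) | here refl = trans (inverted-sym x x-inj m≢k) uv
... | _ | there (here refl) | there (here refl) = contradiction refl m≢k
... | _ , _ , vw | there (here refl) | there (there (here refl)) = vw
... | _ , uw , _ | there (there (here refl)) | here refl = trans (inverted-sym x x-inj m≢k) uw
... | _ , _ , vw | there (there (here refl)) | there (here refl) =
  trans (inverted-sym x x-inj m≢k) vw
... | _ | there (there (here refl)) | there (there (here refl)) = contradiction refl m≢k

-- The middle step does not move the values of α, so the last step would undo the first.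
no-disjoint-conjugation : (x₀ : Word n) → IsPerm x₀ →
  BEdge x₀ α x₁ → BEdge x₁ τ x₂ → BEdge x₂ α x₃ → Disjoint α τ → ⊥
no-disjoint-conjugation {n} {α = a , b} {τ = c , d} x₀ x₀-inj e₁@(_ , refl , _) (_ , refl , _)
                        e₃ α∤τ =
  FinP.<-asym (edge-order x₀ x₀-inj e₁) (subst₂ _<_ pos-a pos-b (edge-order y₂ y₂-inj e₃))
  where
  y₁ y₂ : Word n
  y₁ = map (swapFin a b) x₀
  y₂ = map (swapFin c d) y₁
  y₁-inj : IsPerm y₁
  y₁-inj = swap-perm a b x₀ x₀-inj
  y₂-inj : IsPerm y₂
  y₂-inj = swap-perm c d y₁ y₁-inj
  pos-via : ∀ k → k ∉ c ∷ᴸ d ∷ᴸ []ᴸ → pos y₂ k ≡ pos x₀ (swapFin a b k)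
  pos-via k k∉τ = trans (pos-swap c d y₁ y₁-inj k)
    (trans (cong (pos y₁) (⟦⟧-fixes {t = c , d} k∉τ)) (pos-swap a b x₀ x₀-inj k))
  pos-a : pos y₂ a ≡ pos x₀ b
  pos-a = trans (pos-via a (α∤τ (here refl))) (cong (pos x₀) (swapFin-left a b))
  pos-b : pos y₂ b ≡ pos x₀ a
  pos-b = trans (pos-via b (α∤τ (there (here refl)))) (cong (pos x₀) (swapFin-right a b))

three-step-triple : (x₀ : Word n) → IsPerm x₀ →
  BEdge x₀ α x₁ → BEdge x₁ β x₂ → BEdge x₂ γ x₃ → r < z → x₃ ≡ map (swapFin r z) x₀ →
  ∃ λ e → e ∉ r ∷ᴸ z ∷ᴸ []ᴸ × supp α ⊆ e ∷ᴸ r ∷ᴸ z ∷ᴸ []ᴸ × supp β ⊆ e ∷ᴸ r ∷ᴸ z ∷ᴸ []ᴸ ×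
          supp γ ⊆ e ∷ᴸ r ∷ᴸ z ∷ᴸ []ᴸ × ℓ₃ x₀ e r z ≡ 0 × ℓ₃ x₃ e r z ≡ 3
three-step-triple {r = r} {z = z} x₀ x₀-inj e₁ e₂ e₃ r<z x₃≡τx₀
  with three-transp (proj₁ e₁) (proj₁ e₂) (proj₁ e₃) r<z
         (consecutive-labels-differ e₁ e₂) (consecutive-labels-differ e₂ e₃)
         (three-step-product {τ = r , z} x₀ x₀-inj e₁ e₂ e₃ x₃≡τx₀)
... | inj₁ (refl , refl , α∤τ) = ⊥-elim (no-disjoint-conjugation x₀ x₀-inj e₁ e₂ e₃ α∤τ)
... | inj₂ (e , e∉rz , α⊆ , β⊆ , γ⊆) =
  e , e∉rz , α⊆ , β⊆ , γ⊆ ,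
  three-steps-within-triple x₀ x₀-inj e₁ e₂ e₃
    ((λ e≡r → e∉rz (here e≡r)) , (λ e≡z → e∉rz (there (here e≡z))) , FinP.<⇒≢ r<z) α⊆ β⊆ γ⊆

-- Colourings and the partition generated by the labels

-- Subsets of [n] serve as two-colourings of the values.
paint : Subset n → Word n → Vec Bool n
paint S x = map (lookup S) x

paint-swap : lookup S a ≡ lookup S b → (x : Word n) → paint S (map (swapFin a b) x) ≡ paint S x
paint-swap {S = S} {a = a} {b = b} Sa≡Sb x =
  trans (sym (VecP.map-∘ (lookup S) (swapFin a b) x)) (VecP.map-cong same-colour x)
  where
  same-colour : ∀ k → lookup S (swapFin a b k) ≡ lookup S k
  same-colour k with swapFin-cases a b k
  ... | inj₁ (refl , e) = trans (cong (lookup S) e) (sym Sa≡Sb)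
  ... | inj₂ (inj₁ (refl , e)) = trans (cong (lookup S) e) Sa≡Sb
  ... | inj₂ (inj₂ (_ , _ , e)) = cong (lookup S) e

paint-swap⁻¹ : (x : Word n) → IsPerm x → paint S (map (swapFin a b) x) ≡ paint S x →
               lookup S a ≡ lookup S b
paint-swap⁻¹ {S = S} {a = a} {b = b} x x-inj Sy≡Sx =
  sym (trans (cong (lookup S) (sym (swapFin-left a b)))
             (map-perm-injective x x-inj (lookup S ∘ swapFin a b) (lookup S)
               (trans (VecP.map-∘ (lookup S) (swapFin a b) x) Sy≡Sx) a))

Monochrome : Subset n → Transp n → Set
Monochrome S (a , b) = lookup S a ≡ lookup S b

edge-paint : Monochrome S t → BEdge x t y → paint S x ≡ paint S y
edge-paint {S = S} {t = a , b} {x = x} Sa≡Sb (_ , refl , _) = sym (paint-swap {S = S} Sa≡Sb x)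

edge-paint⁻¹ : IsPerm x → BEdge x t y → paint S x ≡ paint S y → Monochrome S t
edge-paint⁻¹ {x = x} {t = a , b} {S = S} x-inj (_ , refl , _) Sx≡Sy =
  paint-swap⁻¹ {S = S} x x-inj (sym Sx≡Sy)

Steady : Subset n → Path n h → Set
Steady S p = ∀ i → paint S (lookup p (inject₁ i)) ≡ paint S (lookup p (Fin.suc i))

steady-middle : IsPerm x₀ → BEdge x₀ γ x₁ → BEdge x₁ δ x₂ →
                paint S x₂ ≡ paint S x₀ → paint S x₁ ≡ paint S x₀
steady-middle {x₀ = x₀} {γ = c₁ , c₂} {δ = δ} {x₂ = x₂} {S = S} x₀-inj e₁@(pγ , refl , _) e₂ S₂≡S₀ =
  paint-swap {S = S}
    (colour-product (lookup S) pγ (proj₁ e₂) (consecutive-labels-differ e₁ e₂) invariant) x₀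
  where
  invariant : ∀ k → lookup S (⟦ δ ⟧ (swapFin c₁ c₂ k)) ≡ lookup S k
  invariant = map-perm-injective x₀ x₀-inj _ (lookup S) (begin
    map (lookup S ∘ (⟦ δ ⟧ ∘ swapFin c₁ c₂)) x₀
      ≡⟨ VecP.map-∘ (lookup S) (⟦ δ ⟧ ∘ swapFin c₁ c₂) x₀ ⟩
    paint S (map (⟦ δ ⟧ ∘ swapFin c₁ c₂) x₀)
      ≡⟨ cong (paint S) (edges-compose e₁ e₂) ⟨
    paint S x₂
      ≡⟨ S₂≡S₀ ⟩
    paint S x₀ ∎)
    where open ≡-Reasoning

label : (p : Path n h) → IsPath p → Fin h → Transp n
label p p-path i = proj₁ (proj₂ p-path i)

label-edge : (p : Path n h) (p-path : IsPath p) (i : Fin h) →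
             BEdge (lookup p (inject₁ i)) (label p p-path i) (lookup p (Fin.suc i))
label-edge p p-path i = proj₂ (proj₂ p-path i)

steady-by-labels : (p : Path n h) (p-path : IsPath p) →
                   (∀ i → Monochrome S (label p p-path i)) → Steady S p
steady-by-labels {S = S} p p-path monochrome i =
  edge-paint {S = S} (monochrome i) (label-edge p p-path i)

inject₁≢suc : (i : Fin h) → inject₁ i ≢ Fin.suc i
inject₁≢suc i e = ℕP.1+n≢n (sym (trans (sym (FinP.toℕ-inject₁ i)) (cong toℕ e)))

interior-neighbours : (k : Fin (suc h)) → 0 ℕ.< toℕ k → toℕ k ℕ.< h →
                      ∃₂ λ i₀ i₁ → Fin.suc i₀ ≡ k × inject₁ i₁ ≡ k
interior-neighbours (Fin.suc i₀) _ k<h =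
  i₀ , Fin.fromℕ< k<h , refl ,
  FinP.toℕ-injective (trans (FinP.toℕ-inject₁ _) (FinP.toℕ-fromℕ< k<h))

-- Only the vertex at k changes; its neighbours keep their paint, and steady-middle
-- carries it across k.
flip-steady : Flip p q → Steady S p → Steady S q
flip-steady {n} {h} {p = p} {q = q} {S = S} (_ , q-path , k , 0<k , k<h , agree) steady-p
  with interior-neighbours k 0<k k<h
... | i₀ , i₁ , refl , inject-i₁≡k = λ i → at-edge i (i FinP.≟ i₀) (i FinP.≟ i₁)
  where
  open ≡-Reasoning
  Paint : Fin (suc h) → Vec Bool n
  Paint j = paint S (lookup q j)
  ends : Paint (inject₁ i₀) ≡ Paint (Fin.suc i₁)
  ends = begin
    Paint (inject₁ i₀)                     ≡⟨ cong (paint S) (agree _ (inject₁≢suc i₀)) ⟨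
    paint S (lookup p (inject₁ i₀))        ≡⟨ steady-p i₀ ⟩
    paint S (lookup p (Fin.suc i₀))        ≡⟨ cong (paint S ∘ lookup p) inject-i₁≡k ⟨
    paint S (lookup p (inject₁ i₁))        ≡⟨ steady-p i₁ ⟩
    paint S (lookup p (Fin.suc i₁))
      ≡⟨ cong (paint S) (agree _ (λ e → inject₁≢suc i₁ (trans inject-i₁≡k (sym e)))) ⟩
    Paint (Fin.suc i₁)                     ∎
  middle : Paint (Fin.suc i₀) ≡ Paint (inject₁ i₀)
  middle = steady-middle {S = S} (proj₁ q-path (inject₁ i₀)) (label-edge q q-path i₀)
    (subst (λ j → BEdge (lookup q j) _ (lookup q (Fin.suc i₁))) inject-i₁≡k
           (label-edge q q-path i₁))
    (sym ends)
  at-edge : ∀ i → Dec (i ≡ i₀) → Dec (i ≡ i₁) → Paint (inject₁ i) ≡ Paint (Fin.suc i)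
  at-edge i (yes refl) _ = sym middle
  at-edge i (no _) (yes refl) = trans (cong Paint inject-i₁≡k) (trans middle ends)
  at-edge i (no i≢i₀) (no i≢i₁) = begin
    Paint (inject₁ i)
      ≡⟨ cong (paint S) (agree _ (i≢i₁ ∘ FinP.inject₁-injective ∘ flip trans (sym inject-i₁≡k))) ⟨
    paint S (lookup p (inject₁ i))   ≡⟨ steady-p i ⟩
    paint S (lookup p (Fin.suc i))   ≡⟨ cong (paint S) (agree _ (i≢i₀ ∘ FinP.suc-injective)) ⟩
    Paint (Fin.suc i)                ∎

flip-sym : Flip p q → Flip q p
flip-sym (p-path , q-path , k , 0<k , k<h , agree) =
  q-path , p-path , k , 0<k , k<h , λ j j≢k → sym (agree j j≢k)

class-sym : InClass p q → InClass q p
class-sym = Star.reverse λ {p} {q} → flip-sym {p = p} {q = q}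

class-preserves : (P : Path n h → Set) → (∀ {p q} → Flip p q → P p → P q) →
                  InClass p q → P p → P q
class-preserves P step ε Pp = Pp
class-preserves P step (f ◅ fs) Pp = class-preserves P step fs (step f Pp)

class-path : InClass p q → IsPath p → IsPath q
class-path = class-preserves IsPath λ f _ → proj₁ (proj₂ f)

class-start : InClass p q → lookup q Fin.zero ≡ lookup p Fin.zero
class-start {p = p} p~q = class-preserves (λ q → lookup q Fin.zero ≡ lookup p Fin.zero)
  (λ (_ , _ , k , 0<k , _ , agree) start≡ →
     trans (sym (agree Fin.zero λ 0≡k → ℕP.<-irrefl (cong toℕ 0≡k) 0<k)) start≡)
  p~q refl

class-end : InClass p q → lookup q (Fin.fromℕ h) ≡ lookup p (Fin.fromℕ h)
class-end {h = h} {p = p} p~q =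
  class-preserves (λ q → lookup q (Fin.fromℕ h) ≡ lookup p (Fin.fromℕ h))
    (λ (_ , _ , k , _ , k<h , agree) end≡ →
       trans (sym (agree (Fin.fromℕ h) λ h≡k →
                   ℕP.<-irrefl (trans (sym (cong toℕ h≡k)) (FinP.toℕ-fromℕ h)) k<h)) end≡)
    p~q refl

-- The blocks of the partition of [n] generated by the labels of p.
Linked : Path n h → Fin n → Fin n → Set
Linked {n} p u w = (S : Subset n) → Steady S p → lookup S u ≡ lookup S w

steady? : (S : Subset n) (p : Path n h) → Dec (Steady S p)
steady? S p = FinP.all? λ i → VecP.≡-dec BoolP._≟_ _ _

linked? : (p : Path n h) (u w : Fin n) → Dec (Linked p u w)
linked? p u w with anySubset? (λ S → steady? S p ×-dec ¬? (lookup S u BoolP.≟ lookup S w))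
... | yes (S , steady , differ) = no λ linked → differ (linked S steady)
... | no none = yes λ S steady →
  decidable-stable (lookup S u BoolP.≟ lookup S w) λ differ → none (S , steady , differ)

linked-sym : Linked p u w → Linked p w u
linked-sym linked S steady = sym (linked S steady)

class-linked : InClass p q → Linked p u w → Linked q u w
class-linked p~q linked S steady-q =
  linked S (class-preserves (Steady S) (λ {p} {q} → flip-steady {p = p} {q = q} {S = S})
                            (class-sym p~q) steady-q)

member-colouring : List (Fin n) → Subset n
member-colouring T = Vec.tabulate λ k → does (k ∈? T)

member-colouring-at : (U : List (Fin n)) (k : Fin n) →
                      lookup (member-colouring U) k ≡ does (k ∈? U)
member-colouring-at U k = VecP.lookup∘tabulate (λ j → does (j ∈? U)) k

inside-monochrome : (U : List (Fin n)) → supp t ⊆ U → Monochrome (member-colouring U) t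
inside-monochrome {t = a , b} U t⊆U = begin
  lookup (member-colouring U) a   ≡⟨ member-colouring-at U a ⟩
  does (a ∈? U)                   ≡⟨ dec-true (a ∈? U) (t⊆U (here refl)) ⟩
  true                            ≡⟨ dec-true (b ∈? U) (t⊆U (there (here refl))) ⟨
  does (b ∈? U)                   ≡⟨ member-colouring-at U b ⟨
  lookup (member-colouring U) b   ∎
  where open ≡-Reasoning

outside-monochrome : (U : List (Fin n)) → (∀ {k} → k ∈ supp t → k ∉ U) →
                     Monochrome (member-colouring U) t
outside-monochrome {t = a , b} U t∩U=∅ = begin
  lookup (member-colouring U) a   ≡⟨ member-colouring-at U a ⟩
  does (a ∈? U)                   ≡⟨ dec-false (a ∈? U) (t∩U=∅ (here refl)) ⟩
  false                           ≡⟨ dec-false (b ∈? U) (t∩U=∅ (there (here refl))) ⟨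
  does (b ∈? U)                   ≡⟨ member-colouring-at U b ⟨
  lookup (member-colouring U) b   ∎
  where open ≡-Reasoning

linked-member : (U : List (Fin n)) → Linked p u w → Steady (member-colouring U) p →
                u ∈ U → w ∈ U
linked-member {u = u} {w = w} U linked steady u∈U with w ∈? U
... | yes w∈U = w∈U
... | no w∉U = contradiction (begin
  true                            ≡⟨ dec-true (u ∈? U) u∈U ⟨
  does (u ∈? U)                   ≡⟨ member-colouring-at U u ⟨
  lookup (member-colouring U) u   ≡⟨ linked (member-colouring U) steady ⟩
  lookup (member-colouring U) w   ≡⟨ member-colouring-at U w ⟩
  does (w ∈? U)                   ≡⟨ dec-false (w ∈? U) w∉U ⟩
  false                           ∎) λ ()
  where open ≡-Reasoning

-- Colour by T ∪ {r, z} to get e ∈ T, then by T alone to see that T meets {r, z}.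
linked-into-triple : (q : Path n 4) (q-path : IsPath q) (T : List (Fin n)) →
  (∀ (i : Fin 3) → supp (label q q-path (inject₁ i)) ⊆ T) → label q q-path 3F ≡ (r , z) →
  Linked q r e → e ∉ r ∷ᴸ z ∷ᴸ []ᴸ → e ∈ T × (r ∈ T ⊎ z ∈ T)
linked-into-triple {r = r} {z = z} {e = e} q q-path T inside L₃≡rz linked e∉rz =
  e∈T , meets (r ∈? T) (z ∈? T)
  where
  L₃⊆rz : supp (label q q-path 3F) ⊆ r ∷ᴸ z ∷ᴸ []ᴸ
  L₃⊆rz {k} = subst (λ t → k ∈ supp t) L₃≡rz
  T∪rz-steady : Steady (member-colouring (T ++ r ∷ᴸ z ∷ᴸ []ᴸ)) q
  T∪rz-steady = steady-by-labels {S = member-colouring (T ++ r ∷ᴸ z ∷ᴸ []ᴸ)} q q-path λ where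
    0F → inside-monochrome _ (∈-++⁺ˡ ∘ inside 0F)
    1F → inside-monochrome _ (∈-++⁺ˡ ∘ inside 1F)
    2F → inside-monochrome _ (∈-++⁺ˡ ∘ inside 2F)
    3F → inside-monochrome _ (∈-++⁺ʳ T ∘ L₃⊆rz)
  e∈T : e ∈ T
  e∈T with ∈-++⁻ T (linked-member {p = q} _ linked T∪rz-steady (∈-++⁺ʳ T (here refl)))
  ... | inj₁ e∈T = e∈T
  ... | inj₂ e∈rz = contradiction e∈rz e∉rz
  T-steady : r ∉ T → z ∉ T → Steady (member-colouring T) q
  T-steady r∉T z∉T = steady-by-labels {S = member-colouring T} q q-path λ where
    0F → inside-monochrome T (inside 0F)
    1F → inside-monochrome T (inside 1F)
    2F → inside-monochrome T (inside 2F)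
    3F → outside-monochrome T λ k∈L₃ → case L₃⊆rz k∈L₃ of λ where
      (here refl) → r∉T
      (there (here refl)) → z∉T
  meets : Dec (r ∈ T) → Dec (z ∈ T) → r ∈ T ⊎ z ∈ T
  meets (yes r∈T) _ = inj₁ r∈T
  meets (no _) (yes z∈T) = inj₂ z∈T
  meets (no r∉T) (no z∉T) =
    contradiction (linked-member {p = q} T (linked-sym {p = q} linked) (T-steady r∉T z∉T) e∈T) r∉T

monochrome-triple : IsTransp α → IsTransp β → α ≢ β → r < z →
  supp α ⊆ e ∷ᴸ r ∷ᴸ z ∷ᴸ []ᴸ → supp β ⊆ e ∷ᴸ r ∷ᴸ z ∷ᴸ []ᴸ →
  Monochrome S α → Monochrome S β → Monochrome S (r , z) → Monochrome S (r , e)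
monochrome-triple {r = r} {z = z} {e = e} {S = S} pα pβ α≢β r<z α⊆ β⊆ Sα Sβ Sr≡Sz
  with lookup S r BoolP.≟ lookup S e
... | yes Sr≡Se = Sr≡Se
... | no Sr≢Se = contradiction (trans (≡rz pα α⊆ Sα) (sym (≡rz pβ β⊆ Sβ))) α≢β
  where
  colour-r : k ∈ r ∷ᴸ z ∷ᴸ []ᴸ → lookup S k ≡ lookup S r
  colour-r (here refl) = refl
  colour-r (there (here refl)) = sym Sr≡Sz
  in-rz : k ∈ e ∷ᴸ r ∷ᴸ z ∷ᴸ []ᴸ → lookup S k ≡ lookup S r → k ∈ r ∷ᴸ z ∷ᴸ []ᴸ
  in-rz (here refl) Se≡Sr = contradiction (sym Se≡Sr) Sr≢Se
  in-rz (there k∈rz) _ = k∈rz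
  ≡rz : IsTransp t → supp t ⊆ e ∷ᴸ r ∷ᴸ z ∷ᴸ []ᴸ → Monochrome S t → t ≡ (r , z)
  ≡rz {t = a , b} a<b t⊆ Sa≡Sb with t⊆ (here refl) | t⊆ (there (here refl))
  ... | here refl | here refl = contradiction refl (FinP.<⇒≢ a<b)
  ... | here refl | there b∈rz = contradiction (sym (trans Sa≡Sb (colour-r b∈rz))) Sr≢Se
  ... | there a∈rz | b∈ = supp-⊆⇒≡ a<b r<z λ
    { (here refl) → a∈rz
    ; (there (here refl)) → in-rz b∈ (trans (sym Sa≡Sb) (colour-r a∈rz)) }

-- Times of the vertices of a 4-flipclass

module _ (p : Path n 4) where

  private
    start end : Word n
    start = lookup p Fin.zero
    end = lookup p (Fin.fromℕ 4)

  -- A vertex adjacent to both ends can stand at time 1 or at time 3 of a path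
  -- from start to end; within the flipclass of p it stands at time 1 exactly when:
  Early : Word n → Set
  Early a = ∃ λ r → ∃ λ z → ∃ λ e → r < z × end ≡ map (swapFin r z) a ×
            e ∉ r ∷ᴸ z ∷ᴸ []ᴸ × Linked p r e × ℓ₃ a e r z ≡ 0

  early? : (a : Word n) → Dec (Early a)
  early? a = FinP.any? λ r → FinP.any? λ z → FinP.any? λ e →
    (r <? z) ×-dec (end ≟ᵂ map (swapFin r z) a) ×-dec ¬? (e ∈? r ∷ᴸ z ∷ᴸ []ᴸ) ×-dec
    linked? p r e ×-dec (ℓ₃ a e r z ℕ.≟ 0)

  FromStart : Word n → Set
  FromStart a = Adjacent start a × (Adjacent a end → Early a)

  time : Word n → Fin 5
  time a =
    if does (a ≟ᵂ start) then 0F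
    else if does (a ≟ᵂ end) then 4F
    else if does (adjacent? start a ×-dec (adjacent? a end →-dec early? a)) then 1F
    else if does (adjacent? a end) then 3F
    else 2F

  time-start : ∀ {a} → a ≡ start → time a ≡ 0F
  time-start {a} a≡start rewrite dec-true (a ≟ᵂ start) a≡start = refl

  time-end : ∀ {a} → a ≢ start → a ≡ end → time a ≡ 4F
  time-end {a} a≢start a≡end
    rewrite dec-false (a ≟ᵂ start) a≢start | dec-true (a ≟ᵂ end) a≡end = refl

  time-from-start : ∀ {a} → a ≢ start → a ≢ end → FromStart a → time a ≡ 1F
  time-from-start {a} a≢start a≢end from-start
    rewrite dec-false (a ≟ᵂ start) a≢start | dec-false (a ≟ᵂ end) a≢end
          | dec-true (adjacent? start a ×-dec (adjacent? a end →-dec early? a)) from-start = refl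

  time-to-end : ∀ {a} → a ≢ start → a ≢ end → ¬ FromStart a → Adjacent a end → time a ≡ 3F
  time-to-end {a} a≢start a≢end not-from-start to-end
    rewrite dec-false (a ≟ᵂ start) a≢start | dec-false (a ≟ᵂ end) a≢end
          | dec-false (adjacent? start a ×-dec (adjacent? a end →-dec early? a)) not-from-start
          | dec-true (adjacent? a end) to-end = refl

  time-middle : ∀ {a} → a ≢ start → a ≢ end → ¬ Adjacent start a → ¬ Adjacent a end → time a ≡ 2F
  time-middle {a} a≢start a≢end not-from-start not-to-end
    rewrite dec-false (a ≟ᵂ start) a≢start | dec-false (a ≟ᵂ end) a≢end
          | dec-false (adjacent? start a ×-dec (adjacent? a end →-dec early? a))
                      (not-from-start ∘ proj₁)
          | dec-false (adjacent? a end) not-to-end = refl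

  early-at-time-1 : {q : Path n 4} → InClass p q → IsPath q →
                    Adjacent (lookup q 1F) end → Early (lookup q 1F)
  early-at-time-1 {q = q@(y₀ ∷ y₁ ∷ y₂ ∷ y₃ ∷ y₄ ∷ [])} p~q q-path (r , z , r<z , end≡) =
    let e , e∉rz , L₁⊆ , L₂⊆ , _ , ℓ₃≡0 , _ = three-step-triple y₁ P₁ E₁ E₂ E₃ r<z y₄≡
    in r , z , e , r<z , end≡ , e∉rz , class-linked (class-sym p~q) (linked-in-q L₁⊆ L₂⊆) , ℓ₃≡0
    where
    P₁ : IsPerm y₁
    P₁ = proj₁ q-path 1F
    E₁ : BEdge y₁ (label q q-path 1F) y₂
    E₁ = label-edge q q-path 1F
    E₂ : BEdge y₂ (label q q-path 2F) y₃
    E₂ = label-edge q q-path 2F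
    E₃ : BEdge y₃ (label q q-path 3F) y₄
    E₃ = label-edge q q-path 3F
    y₄≡ : y₄ ≡ map (swapFin r z) y₁
    y₄≡ = trans (class-end p~q) end≡
    linked-in-q : supp (label q q-path 1F) ⊆ e ∷ᴸ r ∷ᴸ z ∷ᴸ []ᴸ →
                  supp (label q q-path 2F) ⊆ e ∷ᴸ r ∷ᴸ z ∷ᴸ []ᴸ → Linked q r e
    linked-in-q L₁⊆ L₂⊆ S steady =
      monochrome-triple {S = S} (proj₁ E₁) (proj₁ E₂) (consecutive-labels-differ E₁ E₂) r<z L₁⊆ L₂⊆
        (edge-paint⁻¹ {S = S} P₁ E₁ (steady 1F))
        (edge-paint⁻¹ {S = S} (proj₁ q-path 2F) E₂ (steady 2F))
        (paint-swap⁻¹ {S = S} y₁ P₁ (begin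
          paint S (map (swapFin r z) y₁)   ≡⟨ cong (paint S) y₄≡ ⟨
          paint S y₄                       ≡⟨ steady 3F ⟨
          paint S y₃                       ≡⟨ steady 2F ⟨
          paint S y₂                       ≡⟨ steady 1F ⟨
          paint S y₁                       ∎))
      where open ≡-Reasoning

  not-early-at-time-3 : {q : Path n 4} → InClass p q → IsPath q →
                        Adjacent start (lookup q 3F) → ¬ Early (lookup q 3F)
  not-early-at-time-3 {q = q@(y₀ ∷ y₁ ∷ y₂ ∷ y₃ ∷ y₄ ∷ [])} p~q q-path (c , d , c<d , y₃≡)
                      (r , z , e , r<z , end≡ , e∉rz , linked , ℓ₃≡0) =
    let e′ , _ , L₀⊆ , L₁⊆ , L₂⊆ , _ , ℓ₃≡3 =
          three-step-triple y₀ (proj₁ q-path 0F) (edge 0F) (edge 1F) (edge 2F) c<d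
            (trans y₃≡ (cong (map (swapFin c d)) (sym (class-start p~q))))
        e∈T , r∈T⊎z∈T = linked-into-triple q q-path (e′ ∷ᴸ c ∷ᴸ d ∷ᴸ []ᴸ)
                          (λ { 0F → L₀⊆ ; 1F → L₁⊆ ; 2F → L₂⊆ }) L₃≡rz (class-linked p~q linked) e∉rz
    in case r∈T⊎z∈T of λ where
         (inj₁ r∈T) → contradiction
           (trans (sym er-sorted) (ℓ₃≡3⇒inverted y₃ (proj₁ q-path 3F) ℓ₃≡3 e∈T r∈T e≢r)) λ ()
         (inj₂ z∈T) → contradiction
           (trans (sym ez-sorted) (ℓ₃≡3⇒inverted y₃ (proj₁ q-path 3F) ℓ₃≡3 e∈T z∈T e≢z)) λ ()
    where
    edge : (i : Fin 4) → BEdge (lookup q (inject₁ i)) (label q q-path i) (lookup q (Fin.suc i))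
    edge = label-edge q q-path
    L₃≡rz : label q q-path 3F ≡ (r , z)
    L₃≡rz = transp-unique (proj₁ (edge 3F)) r<z
      (map-perm-injective y₃ (proj₁ q-path 3F) ⟦ label q q-path 3F ⟧ (swapFin r z)
        (trans (sym (edge-target (edge 3F))) (trans (class-end p~q) end≡)))
    e≢r : e ≢ r
    e≢r e≡r = e∉rz (here e≡r)
    e≢z : e ≢ z
    e≢z e≡z = e∉rz (there (here e≡z))
    er-sorted : inverted y₃ e r ≡ 0
    er-sorted = ℕP.m+n≡0⇒m≡0 _ (ℕP.m+n≡0⇒m≡0 _ ℓ₃≡0)
    ez-sorted : inverted y₃ e z ≡ 0
    ez-sorted = ℕP.m+n≡0⇒n≡0 (inverted y₃ e r) (ℕP.m+n≡0⇒m≡0 _ ℓ₃≡0)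

  time-in-class : {q : Path n 4} → InClass p q → IsPath p → ∀ k → time (lookup q k) ≡ k
  time-in-class {q = q@(y₀ ∷ y₁ ∷ y₂ ∷ y₃ ∷ y₄ ∷ [])} p~q p-path = λ where
      0F → time-start y₀≡start
      1F →
        time-from-start (≢start (ℓ 0F)) (≢end (ℓ 1F ⟨<⟩ ℓ 2F ⟨<⟩ ℓ 3F))
          (subst (λ x → Adjacent x y₁) y₀≡start (edge-adjacent (edge 0F)) ,
           early-at-time-1 p~q q-path)
      2F →
        time-middle (≢start (ℓ 0F ⟨<⟩ ℓ 1F)) (≢end (ℓ 2F ⟨<⟩ ℓ 3F))
          (two-steps-not-adjacent (proj₁ q-path 0F) (edge 0F) (edge 1F)
             ∘ subst (λ x → Adjacent x y₂) (sym y₀≡start))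
          (two-steps-not-adjacent (proj₁ q-path 2F) (edge 2F) (edge 3F)
             ∘ subst (Adjacent y₂) (sym y₄≡end))
      3F →
        time-to-end (≢start (ℓ 0F ⟨<⟩ ℓ 1F ⟨<⟩ ℓ 2F)) (≢end (ℓ 3F))
          (λ (from-start , early) → not-early-at-time-3 p~q q-path from-start (early to-end)) to-end
      4F →
        time-end (≢start (ℓ 0F ⟨<⟩ ℓ 1F ⟨<⟩ ℓ 2F ⟨<⟩ ℓ 3F)) y₄≡end
    where
    q-path : IsPath q
    q-path = class-path p~q p-path
    y₀≡start : y₀ ≡ start
    y₀≡start = class-start p~q
    y₄≡end : y₄ ≡ end
    y₄≡end = class-end p~q
    edge : (i : Fin 4) → BEdge (lookup q (inject₁ i)) (label q q-path i) (lookup q (Fin.suc i))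
    edge = label-edge q q-path
    ℓ : (i : Fin 4) → len (lookup q (inject₁ i)) ℕ.< len (lookup q (Fin.suc i))
    ℓ i = edge-len (edge i)
    _⟨<⟩_ : ∀ {i j k} → i ℕ.< j → j ℕ.< k → i ℕ.< k
    _⟨<⟩_ = ℕP.<-trans
    infixr 5 _⟨<⟩_
    ≢start : ∀ {y} → len y₀ ℕ.< len y → y ≢ start
    ≢start ℓ₀<ℓ y≡start = ≢-by-len ℓ₀<ℓ (trans y≡start (sym y₀≡start))
    ≢end : ∀ {y} → len y ℕ.< len y₄ → y ≢ end
    ≢end ℓ<ℓ₄ y≡end = ≢-by-len ℓ<ℓ₄ (trans y₄≡end (sym y≡end))
    to-end : Adjacent y₃ end
    to-end = subst (Adjacent y₃) y₄≡end (edge-adjacent (edge 3F))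

proposition7p7 : (n : ℕ) (p : Path n 4) → IsPath p →
    Iso (Support p) (TimeSupport p)
proposition7p7 n p p-path = record
  { to = λ a → a , time p a
  ; from = proj₁
  ; to-V = λ { a (q , p~q , k , qk≡a) →
      q , p~q , subst (λ j → lookup q j ≡ a) (sym (at-time p~q k qk≡a)) qk≡a }
  ; from-V = λ { (a , k) (q , p~q , qk≡a) → q , p~q , k , qk≡a }
  ; from∘to = λ _ _ → refl
  ; to∘from = λ { (a , k) (q , p~q , qk≡a) → cong (a ,_) (at-time p~q k qk≡a) }
  ; edge-to = λ { a t b _ _ (q , p~q , i , qi≡a , qi′≡b , e) →
      q , p~q , i , sym (at-time p~q _ qi≡a) , sym (at-time p~q _ qi′≡b) , qi≡a , qi′≡b , e }
  ; edge-from = λ { a t b _ _ (q , p~q , i , _ , _ , qi≡a , qi′≡b , e) →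
      q , p~q , i , qi≡a , qi′≡b , e }
  }
  where
  at-time : {q : Path n 4} {a : Word n} → InClass p q → ∀ k → lookup q k ≡ a → time p a ≡ k
  at-time p~q k refl = time-in-class p p~q p-path k
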